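{- Let $A$ be a $K$-bialgebra and $(f,g,d,h,m)$ an NCS system over the underlying algebra of $A$, with coefficients $f(t)=\sum_{m\ge0}t^m\lambda_m$, $g(t)=\sum_{m\ge0}t^ms_m$, $d(t)=\sum_{m\ge1}\frac{t^m}{m}\phi_m$, $h(t)=\sum_{m\ge1}t^{m-1}\psi_m$, $m(t)=\sum_{m\ge1}t^{m-1}\xi_m$. Then the following are equivalent: (1) $\{\lambda_m\}_{m\ge0}$ is a sequence of divided powers of $A$; (2) $\{s_m\}_{m\ge0}$ is a sequence of divided powers of $A$; (3) one (and hence each) of the following holds: every $\phi_m$ ($m\ge1$) is primitive in $A$; every $\psi_m$ ($m\ge1$) is primitive in $A$; every $\xi_m$ ($m\ge1$) is primitive in $A$.
   Context: $K$ is a unital commutative $\mathbb{Q}$-algebra; $t$ is a formal central parameter. An NCS system over $A$ is a $5$-tuple $(f(t),g(t),d(t),h(t),m(t))\in A[[t]]^{\times5}$ with $d(0)=0$ satisfying $f(0)=1$; $f(-t)g(t)=g(t)f(-t)=1$; $e^{d(t)}=g(t)$ (with $e^{d(t)}=\sum_{k\ge0}d(t)^k/k!$); $g'(t)=g(t)h(t)$; $g'(t)=m(t)g(t)$, where $'$ denotes $d/dt$. In a $K$-bialgebra with coproduct $\Delta$, $x$ is primitive if $\Delta(x)=1\otimes x+x\otimes1$; a sequence $\{a_m\}_{m\ge0}$ is a sequence of divided powers if $\Delta(a_m)=\sum_{k+l=m,\,k,l\ge0}a_k\otimes a_l$ for every $m\ge0$. -}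

module Defs where

open import Level using (Level; _⊔_) renaming (suc to lsuc)
open import Algebra.Bundles using (CommutativeRing; Ring)
open import Algebra.Morphism.Structures using (IsRingHomomorphism)
open import Data.Rational as ℚ using (ℚ)
import Data.Rational.Properties as ℚP
open import Data.Integer using (+_)
open import Data.Nat using (ℕ; zero; suc; _∸_; _!)
open import Data.Nat.Properties using (_!≢0)
open import Data.List using (List; []; _∷_; [_]; _++_; map; concatMap; foldr; upTo)
open import Data.Product using (_×_; _,_; proj₁; proj₂)

record QAlgebra (c ℓ : Level) : Set (lsuc (c ⊔ ℓ)) where
  field
    commutativeRing : CommutativeRing c ℓ
  open CommutativeRing commutativeRing public
  field
    fromℚ : ℚ → Carrier
    fromℚ-isRingHomomorphism :
      IsRingHomomorphism (CommutativeRing.rawRing ℚP.+-*-commutativeRing) rawRing fromℚ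

record KAlgebra {k kℓ : Level} (K : QAlgebra k kℓ) (a ℓ : Level) : Set (k ⊔ kℓ ⊔ lsuc (a ⊔ ℓ)) where
  private module K = QAlgebra K
  field
    baseRing : Ring a ℓ
  open Ring baseRing public
  infixr 7 _•_
  field
    _•_ : K.Carrier → Carrier → Carrier
    •-cong : ∀ {x y u v} → x K.≈ y → u ≈ v → (x • u) ≈ (y • v)
    •-distribˡ : ∀ x u v → (x • (u + v)) ≈ ((x • u) + (x • v))
    •-distribʳ : ∀ x y u → ((x K.+ y) • u) ≈ ((x • u) + (y • u))
    •-assoc : ∀ x y u → ((x K.* y) • u) ≈ (x • (y • u))
    •-identity : ∀ u → (K.1# • u) ≈ u
    •-*-assocˡ : ∀ x u v → ((x • u) * v) ≈ (x • (u * v))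
    •-*-assocʳ : ∀ x u v → (u * (x • v)) ≈ (x • (u * v))

-- Tensor products A ⊗_K A and A ⊗_K A ⊗_K A, presented as formal sums
-- (lists) of elementary tensors modulo the defining relations
-- (commutativity of addition, bi-/tri-additivity, K-balancedness).

module Tensors {k kℓ a ℓ : Level} {K : QAlgebra k kℓ} (A : KAlgebra K a ℓ) where
  private module K = QAlgebra K
  open KAlgebra A

  T₂ : Set a
  T₂ = List (Carrier × Carrier)

  infix 4 _≈⊗_
  data _≈⊗_ : T₂ → T₂ → Set (k ⊔ a ⊔ ℓ) where
    ⊗-refl  : ∀ {xs} → xs ≈⊗ xs
    ⊗-sym   : ∀ {xs ys} → xs ≈⊗ ys → ys ≈⊗ xs
    ⊗-trans : ∀ {xs ys zs} → xs ≈⊗ ys → ys ≈⊗ zs → xs ≈⊗ zs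
    ⊗-++-cong : ∀ {xs xs′ ys ys′} → xs ≈⊗ xs′ → ys ≈⊗ ys′ → (xs ++ ys) ≈⊗ (xs′ ++ ys′)
    ⊗-++-comm : ∀ xs ys → (xs ++ ys) ≈⊗ (ys ++ xs)
    ⊗-cong : ∀ {u u′ v v′} → u ≈ u′ → v ≈ v′ → [ (u , v) ] ≈⊗ [ (u′ , v′) ]
    ⊗-+ˡ : ∀ u u′ v → [ (u + u′ , v) ] ≈⊗ ((u , v) ∷ (u′ , v) ∷ [])
    ⊗-+ʳ : ∀ u v v′ → [ (u , v + v′) ] ≈⊗ ((u , v) ∷ (u , v′) ∷ [])
    ⊗-0ˡ : ∀ v → [ (0# , v) ] ≈⊗ []
    ⊗-0ʳ : ∀ u → [ (u , 0#) ] ≈⊗ []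
    ⊗-bal : ∀ x u v → [ (x • u , v) ] ≈⊗ [ (u , x • v) ]

  _•⊗_ : K.Carrier → T₂ → T₂
  x •⊗ xs = map (λ p → (x • proj₁ p , proj₂ p)) xs

  _*⊗_ : T₂ → T₂ → T₂
  xs *⊗ ys = concatMap (λ p → map (λ q → (proj₁ p * proj₁ q , proj₂ p * proj₂ q)) ys) xs

  1⊗ : T₂
  1⊗ = [ (1# , 1#) ]

  T₃ : Set a
  T₃ = List (Carrier × Carrier × Carrier)

  infix 4 _≈⊗₃_
  data _≈⊗₃_ : T₃ → T₃ → Set (k ⊔ a ⊔ ℓ) where
    ⊗₃-refl  : ∀ {xs} → xs ≈⊗₃ xs
    ⊗₃-sym   : ∀ {xs ys} → xs ≈⊗₃ ys → ys ≈⊗₃ xs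
    ⊗₃-trans : ∀ {xs ys zs} → xs ≈⊗₃ ys → ys ≈⊗₃ zs → xs ≈⊗₃ zs
    ⊗₃-++-cong : ∀ {xs xs′ ys ys′} → xs ≈⊗₃ xs′ → ys ≈⊗₃ ys′ → (xs ++ ys) ≈⊗₃ (xs′ ++ ys′)
    ⊗₃-++-comm : ∀ xs ys → (xs ++ ys) ≈⊗₃ (ys ++ xs)
    ⊗₃-cong : ∀ {u u′ v v′ w w′} → u ≈ u′ → v ≈ v′ → w ≈ w′ →
              [ (u , v , w) ] ≈⊗₃ [ (u′ , v′ , w′) ]
    ⊗₃-+₁ : ∀ u u′ v w → [ (u + u′ , v , w) ] ≈⊗₃ ((u , v , w) ∷ (u′ , v , w) ∷ [])
    ⊗₃-+₂ : ∀ u v v′ w → [ (u , v + v′ , w) ] ≈⊗₃ ((u , v , w) ∷ (u , v′ , w) ∷ [])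
    ⊗₃-+₃ : ∀ u v w w′ → [ (u , v , w + w′) ] ≈⊗₃ ((u , v , w) ∷ (u , v , w′) ∷ [])
    ⊗₃-0₁ : ∀ v w → [ (0# , v , w) ] ≈⊗₃ []
    ⊗₃-0₂ : ∀ u w → [ (u , 0# , w) ] ≈⊗₃ []
    ⊗₃-0₃ : ∀ u v → [ (u , v , 0#) ] ≈⊗₃ []
    ⊗₃-bal₁₂ : ∀ x u v w → [ (x • u , v , w) ] ≈⊗₃ [ (u , x • v , w) ]
    ⊗₃-bal₂₃ : ∀ x u v w → [ (u , x • v , w) ] ≈⊗₃ [ (u , v , x • w) ]

record Bialgebra {k kℓ : Level} (K : QAlgebra k kℓ) (a ℓ : Level) : Set (k ⊔ kℓ ⊔ lsuc (a ⊔ ℓ)) where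
  private module K = QAlgebra K
  field
    algebra : KAlgebra K a ℓ
  open KAlgebra algebra public
  open Tensors algebra public
  field
    Δ : Carrier → T₂
    Δ-cong : ∀ {u v} → u ≈ v → Δ u ≈⊗ Δ v
    Δ-+ : ∀ u v → Δ (u + v) ≈⊗ (Δ u ++ Δ v)
    Δ-• : ∀ x u → Δ (x • u) ≈⊗ (x •⊗ Δ u)
    Δ-* : ∀ u v → Δ (u * v) ≈⊗ (Δ u *⊗ Δ v)
    Δ-1 : Δ 1# ≈⊗ 1⊗
    -- coassociativity: (Δ ⊗ id) ∘ Δ = (id ⊗ Δ) ∘ Δ
    Δ-coassoc : ∀ u →
      concatMap (λ p → map (λ q → (proj₁ q , proj₂ q , proj₂ p)) (Δ (proj₁ p))) (Δ u)
        ≈⊗₃ concatMap (λ p → map (λ q → (proj₁ p , proj₁ q , proj₂ q)) (Δ (proj₂ p))) (Δ u)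
    ε : Carrier → K.Carrier
    ε-cong : ∀ {u v} → u ≈ v → ε u K.≈ ε v
    ε-+ : ∀ u v → ε (u + v) K.≈ (ε u K.+ ε v)
    ε-• : ∀ x u → ε (x • u) K.≈ (x K.* ε u)
    ε-* : ∀ u v → ε (u * v) K.≈ (ε u K.* ε v)
    ε-1 : ε 1# K.≈ K.1#
    ε-counitˡ : ∀ u → foldr _+_ 0# (map (λ p → ε (proj₁ p) • proj₂ p) (Δ u)) ≈ u
    ε-counitʳ : ∀ u → foldr _+_ 0# (map (λ p → ε (proj₂ p) • proj₁ p) (Δ u)) ≈ u

module PowerSeries {k kℓ a ℓ : Level} {K : QAlgebra k kℓ} (A : KAlgebra K a ℓ) where
  private module K = QAlgebra K
  open KAlgebra A

  Series : Set a
  Series = ℕ → Carrier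

  infix 4 _≈ₛ_
  _≈ₛ_ : Series → Series → Set ℓ
  p ≈ₛ q = ∀ n → p n ≈ q n

  Σ≤ : ℕ → (ℕ → Carrier) → Carrier
  Σ≤ n f = foldr _+_ 0# (map f (upTo (suc n)))

  infixl 7 _⋆_
  _⋆_ : Series → Series → Series
  (p ⋆ q) n = Σ≤ n (λ i → p i * q (n ∸ i))

  oneₛ : Series
  oneₛ zero = 1#
  oneₛ (suc n) = 0#

  powₛ : Series → ℕ → Series
  powₛ p zero = oneₛ
  powₛ p (suc i) = p ⋆ powₛ p i

  inv! : ℕ → K.Carrier
  inv! i = K.fromℚ (ℚ._/_ (+ 1) (i !) {{i !≢0}})

  natK : ℕ → K.Carrier
  natK n = K.fromℚ (ℚ._/_ (+ n) 1)

  -- e^{d(t)} = Σ_{i≥0} d(t)^i / i!  ; for d(0) = 0 the coefficient of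
  -- t^n only receives contributions from i ≤ n.
  expₛ : Series → Series
  expₛ d n = Σ≤ n (λ i → inv! i • powₛ d i n)

  altSign : ℕ → Carrier → Carrier
  altSign zero u = u
  altSign (suc n) u = - altSign n u

  reflectₛ : Series → Series
  reflectₛ p n = altSign n (p n)

  derivₛ : Series → Series
  derivₛ p n = natK (suc n) • p (suc n)

  record IsNCS (f g d h m : Series) : Set ℓ where
    field
      d-0 : d 0 ≈ 0#
      f-0 : f 0 ≈ 1#
      f-g : reflectₛ f ⋆ g ≈ₛ oneₛ
      g-f : g ⋆ reflectₛ f ≈ₛ oneₛ
      exp-d : expₛ d ≈ₛ g
      g′-h : derivₛ g ≈ₛ g ⋆ h
      g′-m : derivₛ g ≈ₛ m ⋆ g

open PowerSeries public using (Series; IsNCS; natK)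

module _ {k kℓ a ℓ : Level} {K : QAlgebra k kℓ} (B : Bialgebra K a ℓ) where
  open Bialgebra B

  IsPrimitive : Carrier → Set (k ⊔ a ⊔ ℓ)
  IsPrimitive x = Δ x ≈⊗ ((1# , x) ∷ (x , 1#) ∷ [])

  IsDividedPowers : (ℕ → Carrier) → Set (k ⊔ a ⊔ ℓ)
  IsDividedPowers s = ∀ n → Δ (s n) ≈⊗ map (λ i → (s i , s (n ∸ i))) (upTo (suc n))

-- Work with power series over A ⊗ A and write p ⊠ q = (p ⊗ 1)(1 ⊗ q) for the series whose t-coefficients
-- are Σ_{i+j=n} p_i ⊗ q_j. A sequence s is one of divided powers iff Δ s = s ⊠ s, and every coefficient of p
-- is primitive iff Δ p = p ⊗ 1 + 1 ⊗ p. Since p ⊗ 1 and 1 ⊗ q commute, ⊠ is multiplicative, commutes with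
-- t ↦ -t, turns g′ = g h into (g ⊠ g)′ = (g ⊠ g)(h ⊗ 1 + 1 ⊗ h), and turns g = exp d into
-- g ⊠ g = exp (d ⊗ 1 + 1 ⊗ d). So Δ g = g ⊠ g, the statement (2), is equivalent to
--   (1) Δ f = f ⊠ f, because f(-t) is the inverse of g and inverses are unique;
--   (3) Δ h = h ⊗ 1 + 1 ⊗ h and Δ m = m ⊗ 1 + 1 ⊗ m, because an invertible series with constant term 1
--       is determined by its right (left) logarithmic derivative and determines it;
--   (3) Δ d = d ⊗ 1 + 1 ⊗ d, because exp is injective on series without constant term, and this says that
--       the coefficients φₙ = n dₙ of d′ are primitive.
-- The law exp (x + y) = exp x exp y for commuting x, y comes from the fact that s ↦ exp (s x) exp (s y) and
-- s ↦ exp (s (x + y)) solve the same linear differential equation in a second variable s.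

module Submission where

open import Level using (Level; _⊔_)
open import Data.Nat as ℕ using (ℕ; zero; suc; _∸_; _<_; _≤_; z≤n; s≤s; _!)
import Data.Nat.Properties as ℕ
import Data.Integer as ℤ
open import Data.Rational as ℚ using (_/_; 1ℚ; fromℚᵘ)
import Data.Rational.Properties as ℚ
open import Data.Rational.Unnormalised as ℚᵘ using (mkℚᵘ; *≡*)
import Data.Rational.Unnormalised.Properties as ℚᵘ
import Data.Nat.Tactic.RingSolver as ℕ-Solver
import Data.Integer.Tactic.RingSolver as ℤ-Solver
open import Relation.Binary.PropositionalEquality as ≡ using (_≡_)
open import Defs hiding (Series; IsNCS; natK)
open import Algebra.Bundles using (Monoid; Ring; CommutativeMonoid)
open import Relation.Binary.Bundles using (Setoid)
open import Data.Product using (_×_; _,_; proj₁; proj₂)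
open import Data.Sum using (inj₁; inj₂)
open import Function.Bundles using (_⇔_; mk⇔)
open import Function.Properties.Equivalence using () renaming (trans to ⇔-trans; sym to ⇔-sym)
open import Data.List using ([]; _∷_; [_]; _++_; map; concat; foldr; upTo; applyUpTo)
import Data.List.Properties as L
open import Algebra.Morphism.Structures using (IsRingHomomorphism)

module _ {c ℓ : Level} (S : Setoid c ℓ) where
  open Setoid S

  ≈-resp-⇔ : ∀ {x x′ y y′} → x ≈ x′ → y ≈ y′ → (x ≈ y ⇔ x′ ≈ y′)
  ≈-resp-⇔ x≈x′ y≈y′ = mk⇔ (λ x≈y → trans (sym x≈x′) (trans x≈y y≈y′)) (λ x′≈y′ → trans x≈x′ (trans x′≈y′ (sym y≈y′)))

module _ {c ℓ : Level} (M : Monoid c ℓ) where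
  open Monoid M
  open import Relation.Binary.Reasoning.Setoid setoid

  inverse-unique : ∀ {x y x′ y′} → y ∙ x ≈ ε → x′ ∙ y′ ≈ ε → x ≈ x′ → y ≈ y′
  inverse-unique {x} {y} {x′} {y′} yx≈ε x′y′≈ε x≈x′ = begin
    y               ≈⟨ identityʳ y ⟨
    y ∙ ε           ≈⟨ ∙-congˡ x′y′≈ε ⟨
    y ∙ (x′ ∙ y′)   ≈⟨ assoc y x′ y′ ⟨
    (y ∙ x′) ∙ y′   ≈⟨ ∙-congʳ (∙-congˡ x≈x′) ⟨
    (y ∙ x) ∙ y′    ≈⟨ ∙-congʳ yx≈ε ⟩
    ε ∙ y′          ≈⟨ identityˡ y′ ⟩
    y′              ∎

  inverses-≈⇔ : ∀ {x y x′ y′} → x ∙ y ≈ ε → y ∙ x ≈ ε → x′ ∙ y′ ≈ ε → y′ ∙ x′ ≈ ε → (x ≈ x′ ⇔ y ≈ y′)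
  inverses-≈⇔ xy≈ε yx≈ε x′y′≈ε y′x′≈ε = mk⇔ (inverse-unique yx≈ε x′y′≈ε) (inverse-unique xy≈ε y′x′≈ε)

-- The ring-solver identities below are the cross-multiplied equations *≡* asks for, as Agda normalises them.
module RationalArithmetic where
  open ℤ using (+_)
  open ≡ using (trans; sym; cong)

  fromℚᵘ-homo-+ : ∀ p q → fromℚᵘ p ℚ.+ fromℚᵘ q ≡ fromℚᵘ (p ℚᵘ.+ q)
  fromℚᵘ-homo-+ p q = ℚ.toℚᵘ-injective (ℚᵘ.≃-trans (ℚ.toℚᵘ-homo-+ (fromℚᵘ p) (fromℚᵘ q))
    (ℚᵘ.≃-trans (ℚᵘ.+-cong (ℚ.toℚᵘ-fromℚᵘ p) (ℚ.toℚᵘ-fromℚᵘ q)) (ℚᵘ.≃-sym (ℚ.toℚᵘ-fromℚᵘ (p ℚᵘ.+ q)))))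

  fromℚᵘ-homo-* : ∀ p q → fromℚᵘ p ℚ.* fromℚᵘ q ≡ fromℚᵘ (p ℚᵘ.* q)
  fromℚᵘ-homo-* p q = ℚ.toℚᵘ-injective (ℚᵘ.≃-trans (ℚ.toℚᵘ-homo-* (fromℚᵘ p) (fromℚᵘ q))
    (ℚᵘ.≃-trans (ℚᵘ.*-cong (ℚ.toℚᵘ-fromℚᵘ p) (ℚ.toℚᵘ-fromℚᵘ q)) (ℚᵘ.≃-sym (ℚ.toℚᵘ-fromℚᵘ (p ℚᵘ.* q)))))

  1+n/1 : ∀ n → + suc n / 1 ≡ 1ℚ ℚ.+ + n / 1
  1+n/1 n = trans (ℚ.fromℚᵘ-cong {mkℚᵘ (+ suc n) 0} {mkℚᵘ (+ 1) 0 ℚᵘ.+ mkℚᵘ (+ n) 0} (*≡* (identity (+ n))))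
                  (sym (fromℚᵘ-homo-+ (mkℚᵘ (+ 1) 0) (mkℚᵘ (+ n) 0)))
    where
    identity : ∀ x → (+ 1 ℤ.+ x) ℤ.* + 1 ≡ (+ 1 ℤ.* + 1 ℤ.+ x ℤ.* + 1) ℤ.* + 1
    identity = ℤ-Solver.solve-∀

  1/[1+n]*[1+n]/1 : ∀ n → (+ 1 / suc n) ℚ.* (+ suc n / 1) ≡ 1ℚ
  1/[1+n]*[1+n]/1 n = trans (fromℚᵘ-homo-* (mkℚᵘ (+ 1) n) (mkℚᵘ (+ suc n) 0))
    (ℚ.fromℚᵘ-cong {mkℚᵘ (+ 1) n ℚᵘ.* mkℚᵘ (+ suc n) 0} {mkℚᵘ (+ 1) 0} (*≡* (cong (λ k → + suc k) (identity n))))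
    where
    identity : ∀ n → (n ℕ.+ 0 ℕ.* suc n) ℕ.* 1 ≡ n ℕ.* 1 ℕ.+ 0 ℕ.* suc (n ℕ.* 1)
    identity = ℕ-Solver.solve-∀

  [1+i]/1*1/[1+i]k : ∀ i k .{{_ : ℕ.NonZero k}} → (+ suc i / 1) ℚ.* _/_ (+ 1) (suc i ℕ.* k) {{ℕ.m*n≢0 (suc i) k}} ≡ + 1 / k
  [1+i]/1*1/[1+i]k i (suc k) = trans (fromℚᵘ-homo-* (mkℚᵘ (+ suc i) 0) (mkℚᵘ (+ 1) (k ℕ.+ i ℕ.* suc k)))
    (ℚ.fromℚᵘ-cong {mkℚᵘ (+ suc i) 0 ℚᵘ.* mkℚᵘ (+ 1) (k ℕ.+ i ℕ.* suc k)} {mkℚᵘ (+ 1) k} (*≡* (cong (λ j → + suc j) (identity i k))))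
    where
    identity : ∀ i k → k ℕ.+ i ℕ.* 1 ℕ.* suc k ≡ k ℕ.+ i ℕ.* suc k ℕ.+ 0 ℕ.* suc (k ℕ.+ i ℕ.* suc k) ℕ.+ 0 ℕ.* suc (k ℕ.+ i ℕ.* suc k ℕ.+ 0 ℕ.* suc (k ℕ.+ i ℕ.* suc k))
    identity = ℕ-Solver.solve-∀

module QAlgebraArithmetic {k kℓ : Level} (K : QAlgebra k kℓ) where
  open QAlgebra K
  open ℤ using (+_)
  open IsRingHomomorphism fromℚ-isRingHomomorphism
  open import Relation.Binary.Reasoning.Setoid setoid
  open RationalArithmetic

  -- fromℕ n and fromℚ (+ 1 / i !) are, by definition, the natK n and inv! i of PowerSeries
  fromℕ : ℕ → Carrier
  fromℕ n = fromℚ (+ n / 1)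

  fromℕ-0 : fromℕ 0 ≈ 0#
  fromℕ-0 = 0#-homo

  fromℕ-+ : ∀ m n → fromℕ (m ℕ.+ n) ≈ fromℕ m + fromℕ n
  fromℕ-+ zero n = sym (trans (+-congʳ fromℕ-0) (+-identityˡ _))
  fromℕ-+ (suc m) n = begin
    fromℚ (+ suc (m ℕ.+ n) / 1)        ≡⟨ ≡.cong fromℚ (1+n/1 (m ℕ.+ n)) ⟩
    fromℚ (1ℚ ℚ.+ + (m ℕ.+ n) / 1)     ≈⟨ +-homo _ _ ⟩
    fromℚ 1ℚ + fromℕ (m ℕ.+ n)         ≈⟨ +-congˡ (fromℕ-+ m n) ⟩
    fromℚ 1ℚ + (fromℕ m + fromℕ n)     ≈⟨ +-assoc _ _ _ ⟨
    (fromℚ 1ℚ + fromℕ m) + fromℕ n     ≈⟨ +-congʳ (+-homo _ _) ⟨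
    fromℚ (1ℚ ℚ.+ + m / 1) + fromℕ n   ≡⟨ ≡.cong (λ q → fromℚ q + fromℕ n) (1+n/1 m) ⟨
    fromℕ (suc m) + fromℕ n            ∎

  1/[1+n]*[1+n]≈1 : ∀ n → fromℚ (+ 1 / suc n) * fromℕ (suc n) ≈ 1#
  1/[1+n]*[1+n]≈1 n = trans (sym (*-homo _ _)) (trans (reflexive (≡.cong fromℚ (1/[1+n]*[1+n]/1 n))) 1#-homo)

  [1+i]*1/[1+i]!≈1/i! : ∀ i → fromℕ (suc i) * fromℚ (_/_ (+ 1) (suc i !) {{suc i ℕ.!≢0}}) ≈ fromℚ (_/_ (+ 1) (i !) {{i ℕ.!≢0}})
  [1+i]*1/[1+i]!≈1/i! i = trans (sym (*-homo _ _)) (reflexive (≡.cong fromℚ ([1+i]/1*1/[1+i]k i (i !) {{i ℕ.!≢0}})))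

module FiniteSums {c ℓ : Level} (R : Ring c ℓ) where
  open Ring R
  open import Algebra.Properties.CommutativeSemigroup +-commutativeSemigroup using (interchange)
  open import Relation.Binary.Reasoning.Setoid setoid

  -- opaque, so that unification never unfolds a sum of an unknown function
  opaque
    Σ< : ℕ → (ℕ → Carrier) → Carrier
    Σ< zero    f = 0#
    Σ< (suc n) f = f 0 + Σ< n (λ i → f (suc i))

    Σ<-0 : ∀ (f : ℕ → Carrier) → Σ< 0 f ≡ 0#
    Σ<-0 f = ≡.refl

    Σ<-suc : ∀ n (f : ℕ → Carrier) → Σ< (suc n) f ≡ f 0 + Σ< n (λ i → f (suc i))
    Σ<-suc n f = ≡.refl

    foldr-map-applyUpTo : ∀ n (f : ℕ → Carrier) g → foldr _+_ 0# (map f (applyUpTo g n)) ≡ Σ< n (λ i → f (g i))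
    foldr-map-applyUpTo zero    f g = ≡.refl
    foldr-map-applyUpTo (suc n) f g = ≡.cong (f (g 0) +_) (foldr-map-applyUpTo n f (λ i → g (suc i)))

    foldr-map-upTo : ∀ n (f : ℕ → Carrier) → foldr _+_ 0# (map f (upTo n)) ≈ Σ< n f
    foldr-map-upTo n f = reflexive (foldr-map-applyUpTo n f (λ i → i))

    Σ<-cong-< : ∀ n {f g : ℕ → Carrier} → (∀ i → i < n → f i ≈ g i) → Σ< n f ≈ Σ< n g
    Σ<-cong-< zero    f≈g = refl
    Σ<-cong-< (suc n) f≈g = +-cong (f≈g 0 (s≤s z≤n)) (Σ<-cong-< n (λ i i<n → f≈g (suc i) (s≤s i<n)))

    Σ<-zeros : ∀ n {f : ℕ → Carrier} → (∀ i → i < n → f i ≈ 0#) → Σ< n f ≈ 0#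
    Σ<-zeros zero    f≈0 = refl
    Σ<-zeros (suc n) f≈0 = trans (+-cong (f≈0 0 (s≤s z≤n)) (Σ<-zeros n (λ i i<n → f≈0 (suc i) (s≤s i<n)))) (+-identityʳ 0#)

    Σ<-+ : ∀ n (f g : ℕ → Carrier) → Σ< n (λ i → f i + g i) ≈ Σ< n f + Σ< n g
    Σ<-+ zero    f g = sym (+-identityʳ 0#)
    Σ<-+ (suc n) f g = trans (+-congˡ (Σ<-+ n (λ i → f (suc i)) (λ i → g (suc i)))) (interchange _ _ _ _)

    Σ<-distribˡ : ∀ n x (f : ℕ → Carrier) → x * Σ< n f ≈ Σ< n (λ i → x * f i)
    Σ<-distribˡ zero    x f = zeroʳ x
    Σ<-distribˡ (suc n) x f = trans (distribˡ x _ _) (+-congˡ (Σ<-distribˡ n x (λ i → f (suc i))))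

    Σ<-distribʳ : ∀ n x (f : ℕ → Carrier) → Σ< n f * x ≈ Σ< n (λ i → f i * x)
    Σ<-distribʳ zero    x f = zeroˡ x
    Σ<-distribʳ (suc n) x f = trans (distribʳ x _ _) (+-congˡ (Σ<-distribʳ n x (λ i → f (suc i))))

    Σ<-last : ∀ n (f : ℕ → Carrier) → Σ< (suc n) f ≈ Σ< n f + f n
    Σ<-last zero    f = trans (+-identityʳ (f 0)) (sym (+-identityˡ (f 0)))
    Σ<-last (suc n) f = trans (+-congˡ (Σ<-last n (λ i → f (suc i)))) (sym (+-assoc _ _ _))

    Σ<-extend : ∀ {m n} (f : ℕ → Carrier) → m ≤ n → (∀ i → m ≤ i → i < n → f i ≈ 0#) → Σ< m f ≈ Σ< n f
    Σ<-extend {n = n} f z≤n f≈0 = sym (Σ<-zeros n (λ i i<n → f≈0 i z≤n i<n))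
    Σ<-extend f (s≤s m≤n) f≈0 = +-congˡ (Σ<-extend (λ i → f (suc i)) m≤n (λ i m≤i i<n → f≈0 (suc i) (s≤s m≤i) (s≤s i<n)))

    Σ<-reverse : ∀ n (f : ℕ → Carrier) → Σ< n f ≈ Σ< n (λ i → f (n ∸ suc i))
    Σ<-reverse zero    f = refl
    Σ<-reverse (suc n) f = begin
      f 0 + Σ< n (λ i → f (suc i))             ≈⟨ +-congˡ (Σ<-reverse n (λ i → f (suc i))) ⟩
      f 0 + Σ< n (λ i → f (suc (n ∸ suc i)))   ≈⟨ +-comm _ _ ⟩
      Σ< n (λ i → f (suc (n ∸ suc i))) + f 0   ≈⟨ +-cong (Σ<-cong-< n (λ i i<n → reflexive (≡.cong f (≡.sym (ℕ.+-∸-assoc 1 i<n)))))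
                                                          (reflexive (≡.cong f (≡.sym (ℕ.n∸n≡0 n)))) ⟩
      Σ< n (λ i → f (n ∸ i)) + f (n ∸ n)       ≈⟨ Σ<-last n (λ i → f (n ∸ i)) ⟨
      Σ< (suc n) (λ i → f (n ∸ i))             ∎

    Σ<-swap : ∀ m n (F : ℕ → ℕ → Carrier) → Σ< m (λ i → Σ< n (F i)) ≈ Σ< n (λ j → Σ< m (λ i → F i j))
    Σ<-swap zero    n F = sym (Σ<-zeros n (λ _ _ → refl))
    Σ<-swap (suc m) n F = begin
      Σ< n (F 0) + Σ< m (λ i → Σ< n (F (suc i)))         ≈⟨ +-congˡ (Σ<-swap m n (λ i → F (suc i))) ⟩
      Σ< n (F 0) + Σ< n (λ j → Σ< m (λ i → F (suc i) j)) ≈⟨ Σ<-+ n _ _ ⟨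
      Σ< n (λ j → Σ< (suc m) (λ i → F i j))              ∎

    Σ<-triangle : ∀ n (F : ℕ → ℕ → Carrier) →
      Σ< (suc n) (λ i → Σ< (suc i) (λ j → F j (i ∸ j))) ≈ Σ< (suc n) (λ j → Σ< (suc (n ∸ j)) (F j))
    Σ<-triangle zero    F = refl
    Σ<-triangle (suc n) F = begin
      Σ< (suc (suc n)) (λ i → Σ< (suc i) (λ j → F j (i ∸ j)))
        ≈⟨ Σ<-last (suc n) (λ i → Σ< (suc i) (λ j → F j (i ∸ j))) ⟩
      Σ< (suc n) (λ i → Σ< (suc i) (λ j → F j (i ∸ j))) + Σ< (suc (suc n)) (λ j → F j (suc n ∸ j))
        ≈⟨ +-cong (Σ<-triangle n F) (Σ<-last (suc n) (λ j → F j (suc n ∸ j))) ⟩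
      Σ< (suc n) (λ j → Σ< (suc (n ∸ j)) (F j)) + (Σ< (suc n) (λ j → F j (suc n ∸ j)) + F (suc n) (n ∸ n))
        ≈⟨ +-assoc _ _ _ ⟨
      (Σ< (suc n) (λ j → Σ< (suc (n ∸ j)) (F j)) + Σ< (suc n) (λ j → F j (suc n ∸ j))) + F (suc n) (n ∸ n)
        ≈⟨ +-congʳ (Σ<-+ (suc n) (λ j → Σ< (suc (n ∸ j)) (F j)) (λ j → F j (suc n ∸ j))) ⟨
      Σ< (suc n) (λ j → Σ< (suc (n ∸ j)) (F j) + F j (suc n ∸ j)) + F (suc n) (n ∸ n)
        ≈⟨ +-cong (Σ<-cong-< (suc n) extend-row) corner ⟩
      Σ< (suc n) (λ j → Σ< (suc (suc n ∸ j)) (F j)) + Σ< (suc (n ∸ n)) (F (suc n))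
        ≈⟨ Σ<-last (suc n) (λ j → Σ< (suc (suc n ∸ j)) (F j)) ⟨
      Σ< (suc (suc n)) (λ j → Σ< (suc (suc n ∸ j)) (F j)) ∎
      where
      corner : F (suc n) (n ∸ n) ≈ Σ< (suc (n ∸ n)) (F (suc n))
      corner rewrite ℕ.n∸n≡0 n = sym (+-identityʳ _)
      extend-row : ∀ j → j < suc n → Σ< (suc (n ∸ j)) (F j) + F j (suc n ∸ j) ≈ Σ< (suc (suc n ∸ j)) (F j)
      extend-row j (s≤s j≤n) = begin
        Σ< (suc (n ∸ j)) (F j) + F j (suc n ∸ j)    ≡⟨ ≡.cong (λ k → Σ< (suc (n ∸ j)) (F j) + F j k) (ℕ.+-∸-assoc 1 j≤n) ⟩
        Σ< (suc (n ∸ j)) (F j) + F j (suc (n ∸ j))  ≈⟨ Σ<-last (suc (n ∸ j)) (F j) ⟨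
        Σ< (suc (suc (n ∸ j))) (F j)                ≡⟨ ≡.cong (λ k → Σ< (suc k) (F j)) (ℕ.+-∸-assoc 1 j≤n) ⟨
        Σ< (suc (suc n ∸ j)) (F j)                  ∎

  Σ<-cong : ∀ n {f g : ℕ → Carrier} → (∀ i → f i ≈ g i) → Σ< n f ≈ Σ< n g
  Σ<-cong n f≈g = Σ<-cong-< n (λ i _ → f≈g i)

  Σ<-*-Σ< : ∀ m n (f g : ℕ → Carrier) → Σ< m f * Σ< n g ≈ Σ< m (λ i → Σ< n (λ j → f i * g j))
  Σ<-*-Σ< m n f g = trans (Σ<-distribʳ m _ f) (Σ<-cong m (λ i → Σ<-distribˡ n (f i) g))

module Σ<-Homomorphism {c₁ ℓ₁ c₂ ℓ₂ : Level} (R : Ring c₁ ℓ₁) (S : Ring c₂ ℓ₂) where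
  private
    module R = Ring R
    module S = Ring S
    module ΣR = FiniteSums R
    module ΣS = FiniteSums S
  open import Relation.Binary.Reasoning.Setoid S.setoid

  Σ<-homo : (φ : R.Carrier → S.Carrier) → (∀ {x y} → x R.≈ y → φ x S.≈ φ y) → φ R.0# S.≈ S.0# →
            (∀ x y → φ (x R.+ y) S.≈ φ x S.+ φ y) → ∀ n f → φ (ΣR.Σ< n f) S.≈ ΣS.Σ< n (λ i → φ (f i))
  Σ<-homo φ φ-cong φ-0 φ-+ zero f = begin
    φ (ΣR.Σ< 0 f)              ≈⟨ φ-cong (R.reflexive (ΣR.Σ<-0 f)) ⟩
    φ R.0#                     ≈⟨ φ-0 ⟩
    S.0#                       ≡⟨ ΣS.Σ<-0 _ ⟨
    ΣS.Σ< 0 (λ i → φ (f i))    ∎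
  Σ<-homo φ φ-cong φ-0 φ-+ (suc n) f = begin
    φ (ΣR.Σ< (suc n) f)                              ≈⟨ φ-cong (R.reflexive (ΣR.Σ<-suc n f)) ⟩
    φ (f 0 R.+ ΣR.Σ< n (λ i → f (suc i)))            ≈⟨ φ-+ _ _ ⟩
    φ (f 0) S.+ φ (ΣR.Σ< n (λ i → f (suc i)))        ≈⟨ S.+-congˡ (Σ<-homo φ φ-cong φ-0 φ-+ n (λ i → f (suc i))) ⟩
    φ (f 0) S.+ ΣS.Σ< n (λ i → φ (f (suc i)))        ≡⟨ ΣS.Σ<-suc n _ ⟨
    ΣS.Σ< (suc n) (λ i → φ (f i))                    ∎

module KAlgebraProperties {k kℓ a ℓ : Level} {K : QAlgebra k kℓ} (R : KAlgebra K a ℓ) where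
  private module K = QAlgebra K
  open KAlgebra R
  open QAlgebraArithmetic K
  open import Algebra.Properties.Ring baseRing using (x+x≈x⇒x≈0)
  open import Relation.Binary.Reasoning.Setoid setoid

  •-zeroʳ : ∀ x → x • 0# ≈ 0#
  •-zeroʳ x = x+x≈x⇒x≈0 (x • 0#) (trans (sym (•-distribˡ x 0# 0#)) (•-cong K.refl (+-identityʳ 0#)))

  •-zeroˡ : ∀ u → K.0# • u ≈ 0#
  •-zeroˡ u = x+x≈x⇒x≈0 (K.0# • u) (trans (sym (•-distribʳ K.0# K.0# u)) (•-cong (K.+-identityʳ K.0#) refl))

  fromℕ[1+n]•-injective : ∀ n {u v} → fromℕ (suc n) • u ≈ fromℕ (suc n) • v → u ≈ v
  fromℕ[1+n]•-injective n {u} {v} nu≈nv = begin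
    u                                     ≈⟨ •-identity u ⟨
    K.1# • u                              ≈⟨ •-cong (1/[1+n]*[1+n]≈1 n) refl ⟨
    (1/[1+n] K.* fromℕ (suc n)) • u       ≈⟨ •-assoc _ _ _ ⟩
    1/[1+n] • (fromℕ (suc n) • u)         ≈⟨ •-cong K.refl nu≈nv ⟩
    1/[1+n] • (fromℕ (suc n) • v)         ≈⟨ •-assoc _ _ _ ⟨
    (1/[1+n] K.* fromℕ (suc n)) • v       ≈⟨ •-cong (1/[1+n]*[1+n]≈1 n) refl ⟩
    K.1# • v                              ≈⟨ •-identity v ⟩
    v                                     ∎
    where
    1/[1+n] : K.Carrier
    1/[1+n] = K.fromℚ (ℚ._/_ (ℤ.+ 1) (suc n))

module PowerSeriesAlgebra {k kℓ a ℓ : Level} {K : QAlgebra k kℓ} (R : KAlgebra K a ℓ) where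
  private module K = QAlgebra K
  open KAlgebra R
  open PowerSeries R
  open FiniteSums baseRing
  open KAlgebraProperties R
  open QAlgebraArithmetic K using (fromℕ-0; fromℕ-+)
  open Σ<-Homomorphism baseRing baseRing using (Σ<-homo)
  open import Relation.Binary.Reasoning.Setoid setoid

  infixl 6 _+ₛ_
  _+ₛ_ : Series → Series → Series
  (p +ₛ q) n = p n + q n

  -ₛ_ : Series → Series
  (-ₛ p) n = - p n

  0ₛ : Series
  0ₛ n = 0#

  _•ₛ_ : K.Carrier → Series → Series
  (x •ₛ p) n = x • p n

  Σ<-• : ∀ n x (f : ℕ → Carrier) → x • Σ< n f ≈ Σ< n (λ i → x • f i)
  Σ<-• n x = Σ<-homo (x •_) (•-cong K.refl) (•-zeroʳ x) (•-distribˡ x) n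

  ≈ₛ-refl : ∀ {p} → p ≈ₛ p
  ≈ₛ-refl n = refl

  ≈ₛ-sym : ∀ {p q} → p ≈ₛ q → q ≈ₛ p
  ≈ₛ-sym p≈q n = sym (p≈q n)

  ≈ₛ-trans : ∀ {p q r} → p ≈ₛ q → q ≈ₛ r → p ≈ₛ r
  ≈ₛ-trans p≈q q≈r n = trans (p≈q n) (q≈r n)

  Σ≤≈Σ< : ∀ n f → Σ≤ n f ≈ Σ< (suc n) f
  Σ≤≈Σ< n f = foldr-map-upTo (suc n) f

  ⋆-coeff : ∀ p q n → (p ⋆ q) n ≈ Σ< (suc n) (λ i → p i * q (n ∸ i))
  ⋆-coeff p q n = Σ≤≈Σ< n (λ i → p i * q (n ∸ i))

  ⋆-coeff-0 : ∀ p q → (p ⋆ q) 0 ≈ p 0 * q 0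
  ⋆-coeff-0 p q = +-identityʳ _

  ⋆-coeff-cong : ∀ {p p′ q q′} n → (∀ i → i ≤ n → p i ≈ p′ i) → (∀ i → i ≤ n → q i ≈ q′ i) → (p ⋆ q) n ≈ (p′ ⋆ q′) n
  ⋆-coeff-cong {p} {p′} {q} {q′} n p≈p′ q≈q′ = begin
    (p ⋆ q) n                               ≈⟨ ⋆-coeff p q n ⟩
    Σ< (suc n) (λ i → p i * q (n ∸ i))      ≈⟨ Σ<-cong-< (suc n) (λ i i<1+n → *-cong (p≈p′ i (ℕ.≤-pred i<1+n)) (q≈q′ (n ∸ i) (ℕ.m∸n≤m n i))) ⟩
    Σ< (suc n) (λ i → p′ i * q′ (n ∸ i))    ≈⟨ ⋆-coeff p′ q′ n ⟨
    (p′ ⋆ q′) n                             ∎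

  ⋆-cong : ∀ {p p′ q q′} → p ≈ₛ p′ → q ≈ₛ q′ → p ⋆ q ≈ₛ p′ ⋆ q′
  ⋆-cong p≈p′ q≈q′ n = ⋆-coeff-cong n (λ i _ → p≈p′ i) (λ i _ → q≈q′ i)

  ⋆-assoc : ∀ p q r → (p ⋆ q) ⋆ r ≈ₛ p ⋆ (q ⋆ r)
  ⋆-assoc p q r n = begin
    ((p ⋆ q) ⋆ r) n
      ≈⟨ ⋆-coeff (p ⋆ q) r n ⟩
    Σ< (suc n) (λ i → (p ⋆ q) i * r (n ∸ i))
      ≈⟨ Σ<-cong (suc n) (λ i → trans (*-congʳ (⋆-coeff p q i)) (Σ<-distribʳ (suc i) (r (n ∸ i)) _)) ⟩
    Σ< (suc n) (λ i → Σ< (suc i) (λ j → (p j * q (i ∸ j)) * r (n ∸ i)))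
      ≈⟨ Σ<-cong (suc n) (λ i → Σ<-cong-< (suc i) (λ j j<1+i →
           reflexive (≡.cong (λ m → (p j * q (i ∸ j)) * r (n ∸ m)) (≡.sym (ℕ.m+[n∸m]≡n (ℕ.≤-pred j<1+i)))))) ⟩
    Σ< (suc n) (λ i → Σ< (suc i) (λ j → F j (i ∸ j)))
      ≈⟨ Σ<-triangle n F ⟩
    Σ< (suc n) (λ j → Σ< (suc (n ∸ j)) (F j))
      ≈⟨ Σ<-cong (suc n) (λ j → Σ<-cong (suc (n ∸ j)) (λ l →
           trans (*-assoc _ _ _) (reflexive (≡.cong (λ m → p j * (q l * r m)) (≡.sym (ℕ.∸-+-assoc n j l)))))) ⟩
    Σ< (suc n) (λ j → Σ< (suc (n ∸ j)) (λ l → p j * (q l * r ((n ∸ j) ∸ l))))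
      ≈⟨ Σ<-cong (suc n) (λ j → trans (*-congˡ (⋆-coeff q r (n ∸ j))) (Σ<-distribˡ (suc (n ∸ j)) (p j) _)) ⟨
    Σ< (suc n) (λ j → p j * (q ⋆ r) (n ∸ j))
      ≈⟨ ⋆-coeff p (q ⋆ r) n ⟨
    (p ⋆ (q ⋆ r)) n
      ∎
    where
    F : ℕ → ℕ → Carrier
    F j l = (p j * q l) * r (n ∸ (j ℕ.+ l))

  ⋆-distribˡ : ∀ p q r → p ⋆ (q +ₛ r) ≈ₛ p ⋆ q +ₛ p ⋆ r
  ⋆-distribˡ p q r n = begin
    (p ⋆ (q +ₛ r)) n                                                          ≈⟨ ⋆-coeff p (q +ₛ r) n ⟩
    Σ< (suc n) (λ i → p i * (q (n ∸ i) + r (n ∸ i)))                          ≈⟨ Σ<-cong (suc n) (λ i → distribˡ _ _ _) ⟩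
    Σ< (suc n) (λ i → p i * q (n ∸ i) + p i * r (n ∸ i))                      ≈⟨ Σ<-+ (suc n) _ _ ⟩
    Σ< (suc n) (λ i → p i * q (n ∸ i)) + Σ< (suc n) (λ i → p i * r (n ∸ i))   ≈⟨ +-cong (⋆-coeff p q n) (⋆-coeff p r n) ⟨
    (p ⋆ q) n + (p ⋆ r) n                                                     ∎

  ⋆-distribʳ : ∀ p q r → (q +ₛ r) ⋆ p ≈ₛ q ⋆ p +ₛ r ⋆ p
  ⋆-distribʳ p q r n = begin
    ((q +ₛ r) ⋆ p) n                                                          ≈⟨ ⋆-coeff (q +ₛ r) p n ⟩
    Σ< (suc n) (λ i → (q i + r i) * p (n ∸ i))                                ≈⟨ Σ<-cong (suc n) (λ i → distribʳ _ _ _) ⟩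
    Σ< (suc n) (λ i → q i * p (n ∸ i) + r i * p (n ∸ i))                      ≈⟨ Σ<-+ (suc n) _ _ ⟩
    Σ< (suc n) (λ i → q i * p (n ∸ i)) + Σ< (suc n) (λ i → r i * p (n ∸ i))   ≈⟨ +-cong (⋆-coeff q p n) (⋆-coeff r p n) ⟨
    (q ⋆ p) n + (r ⋆ p) n                                                     ∎

  ⋆-identityˡ : ∀ q → oneₛ ⋆ q ≈ₛ q
  ⋆-identityˡ q n = begin
    (oneₛ ⋆ q) n                                             ≈⟨ ⋆-coeff oneₛ q n ⟩
    Σ< (suc n) (λ i → oneₛ i * q (n ∸ i))                    ≡⟨ Σ<-suc n _ ⟩
    1# * q n + Σ< n (λ i → 0# * q (n ∸ suc i))               ≈⟨ +-cong (*-identityˡ _) (Σ<-zeros n (λ i _ → zeroˡ _)) ⟩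
    q n + 0#                                                 ≈⟨ +-identityʳ _ ⟩
    q n                                                      ∎

  ⋆-identityʳ : ∀ q → q ⋆ oneₛ ≈ₛ q
  ⋆-identityʳ q n = begin
    (q ⋆ oneₛ) n                                             ≈⟨ ⋆-coeff q oneₛ n ⟩
    Σ< (suc n) (λ i → q i * oneₛ (n ∸ i))                    ≈⟨ Σ<-last n _ ⟩
    Σ< n (λ i → q i * oneₛ (n ∸ i)) + q n * oneₛ (n ∸ n)     ≈⟨ +-cong (Σ<-zeros n *-zero-at) (*-congˡ (reflexive (≡.cong oneₛ (ℕ.n∸n≡0 n)))) ⟩
    0# + q n * 1#                                            ≈⟨ trans (+-identityˡ _) (*-identityʳ _) ⟩
    q n                                                      ∎
    where
    *-zero-at : ∀ i → i < n → q i * oneₛ (n ∸ i) ≈ 0#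
    *-zero-at i i<n with n ∸ i | ℕ.m<n⇒0<n∸m i<n
    ... | suc _ | _ = zeroʳ _

  ⋆-•ˡ : ∀ x p q → (x •ₛ p) ⋆ q ≈ₛ x •ₛ (p ⋆ q)
  ⋆-•ˡ x p q n = begin
    ((x •ₛ p) ⋆ q) n                              ≈⟨ ⋆-coeff (x •ₛ p) q n ⟩
    Σ< (suc n) (λ i → (x • p i) * q (n ∸ i))      ≈⟨ Σ<-cong (suc n) (λ i → •-*-assocˡ x _ _) ⟩
    Σ< (suc n) (λ i → x • (p i * q (n ∸ i)))      ≈⟨ Σ<-• (suc n) x _ ⟨
    x • Σ< (suc n) (λ i → p i * q (n ∸ i))        ≈⟨ •-cong K.refl (⋆-coeff p q n) ⟨
    x • (p ⋆ q) n                                 ∎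

  ⋆-•ʳ : ∀ x p q → p ⋆ (x •ₛ q) ≈ₛ x •ₛ (p ⋆ q)
  ⋆-•ʳ x p q n = begin
    (p ⋆ (x •ₛ q)) n                              ≈⟨ ⋆-coeff p (x •ₛ q) n ⟩
    Σ< (suc n) (λ i → p i * (x • q (n ∸ i)))      ≈⟨ Σ<-cong (suc n) (λ i → •-*-assocʳ x _ _) ⟩
    Σ< (suc n) (λ i → x • (p i * q (n ∸ i)))      ≈⟨ Σ<-• (suc n) x _ ⟨
    x • Σ< (suc n) (λ i → p i * q (n ∸ i))        ≈⟨ •-cong K.refl (⋆-coeff p q n) ⟨
    x • (p ⋆ q) n                                 ∎

  seriesRing : Ring a ℓ
  seriesRing = record
    { Carrier = Series ; _≈_ = _≈ₛ_ ; _+_ = _+ₛ_ ; _*_ = _⋆_ ; -_ = -ₛ_ ; 0# = 0ₛ ; 1# = oneₛ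
    ; isRing = record
      { +-isAbelianGroup = record
        { isGroup = record
          { isMonoid = record
            { isSemigroup = record
              { isMagma = record
                { isEquivalence = record { refl = λ {p} → ≈ₛ-refl {p} ; sym = λ {p} {q} → ≈ₛ-sym {p} {q} ; trans = λ {p} {q} {r} → ≈ₛ-trans {p} {q} {r} }
                ; ∙-cong = λ p≈p′ q≈q′ n → +-cong (p≈p′ n) (q≈q′ n) }
              ; assoc = λ p q r n → +-assoc (p n) (q n) (r n) }
            ; identity = (λ p n → +-identityˡ (p n)) , (λ p n → +-identityʳ (p n)) }
          ; inverse = (λ p n → -‿inverseˡ (p n)) , (λ p n → -‿inverseʳ (p n))
          ; ⁻¹-cong = λ p≈q n → -‿cong (p≈q n) }
        ; comm = λ p q n → +-comm (p n) (q n) }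
      ; *-cong = λ {p} {p′} {q} {q′} → ⋆-cong {p} {p′} {q} {q′}
      ; *-assoc = ⋆-assoc
      ; *-identity = ⋆-identityˡ , ⋆-identityʳ
      ; distrib = ⋆-distribˡ , ⋆-distribʳ } }

  seriesAlgebra : KAlgebra K a ℓ
  seriesAlgebra = record
    { baseRing = seriesRing
    ; _•_ = _•ₛ_
    ; •-cong = λ x≈y p≈q n → •-cong x≈y (p≈q n)
    ; •-distribˡ = λ x p q n → •-distribˡ x (p n) (q n)
    ; •-distribʳ = λ x y p n → •-distribʳ x y (p n)
    ; •-assoc = λ x y p n → •-assoc x y (p n)
    ; •-identity = λ p n → •-identity (p n)
    ; •-*-assocˡ = ⋆-•ˡ
    ; •-*-assocʳ = ⋆-•ʳ }

  ⋆-comm : ∀ p q → (∀ i j → p i * q j ≈ q j * p i) → p ⋆ q ≈ₛ q ⋆ p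
  ⋆-comm p q pq≈qp n = begin
    (p ⋆ q) n                                          ≈⟨ ⋆-coeff p q n ⟩
    Σ< (suc n) (λ i → p i * q (n ∸ i))                 ≈⟨ Σ<-reverse (suc n) _ ⟩
    Σ< (suc n) (λ i → p (n ∸ i) * q (n ∸ (n ∸ i)))     ≈⟨ Σ<-cong-< (suc n) (λ i i<1+n →
      trans (*-congˡ (reflexive (≡.cong q (ℕ.m∸[m∸n]≡n (ℕ.≤-pred i<1+n))))) (pq≈qp _ _)) ⟩
    Σ< (suc n) (λ i → q i * p (n ∸ i))                 ≈⟨ ⋆-coeff q p n ⟨
    (q ⋆ p) n                                          ∎

  OrderAtLeast : Series → ℕ → Set ℓ
  OrderAtLeast p a = ∀ j → j < a → p j ≈ 0#

  ⋆-order : ∀ {p q a b} → OrderAtLeast p a → OrderAtLeast q b → OrderAtLeast (p ⋆ q) (a ℕ.+ b)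
  ⋆-order {p} {q} {a} {b} p-order q-order n n<a+b = trans (⋆-coeff p q n) (Σ<-zeros (suc n) term≈0)
    where
    term≈0 : ∀ j → j < suc n → p j * q (n ∸ j) ≈ 0#
    term≈0 j j<1+n with ℕ.<-≤-connex j a
    ... | inj₁ j<a = trans (*-congʳ (p-order j j<a)) (zeroˡ _)
    ... | inj₂ a≤j = trans (*-congˡ (q-order (n ∸ j) n∸j<b)) (zeroʳ _)
      where
      n∸j<b : n ∸ j < b
      n∸j<b = ℕ.≤-<-trans (ℕ.∸-monoʳ-≤ n a≤j)
        (ℕ.+-cancelˡ-< a (n ∸ a) b (ℕ.≤-<-trans (ℕ.≤-reflexive (ℕ.m+[n∸m]≡n (ℕ.≤-trans a≤j (ℕ.≤-pred j<1+n)))) n<a+b))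

  powₛ-order : ∀ {p} → p 0 ≈ 0# → ∀ i → OrderAtLeast (powₛ p i) i
  powₛ-order p₀≈0 zero    = λ _ ()
  powₛ-order p₀≈0 (suc i) = ⋆-order {a = 1} (λ { 0 _ → p₀≈0 ; (suc _) (s≤s ()) }) (powₛ-order p₀≈0 i)

  derivₛ-cong : ∀ {p q} → p ≈ₛ q → derivₛ p ≈ₛ derivₛ q
  derivₛ-cong p≈q n = •-cong K.refl (p≈q (suc n))

  derivₛ-+ₛ : ∀ p q → derivₛ (p +ₛ q) ≈ₛ derivₛ p +ₛ derivₛ q
  derivₛ-+ₛ p q n = •-distribˡ _ _ _

  ≈ₛ⇔derivₛ-≈ₛ : ∀ {p q} → p 0 ≈ q 0 → (p ≈ₛ q ⇔ derivₛ p ≈ₛ derivₛ q)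
  ≈ₛ⇔derivₛ-≈ₛ {p} {q} p₀≈q₀ = mk⇔ derivₛ-cong ⇐
    where
    ⇐ : derivₛ p ≈ₛ derivₛ q → p ≈ₛ q
    ⇐ p′≈q′ zero    = p₀≈q₀
    ⇐ p′≈q′ (suc n) = fromℕ[1+n]•-injective n (p′≈q′ n)

  derivₛ-⋆ : ∀ p q → derivₛ (p ⋆ q) ≈ₛ derivₛ p ⋆ q +ₛ p ⋆ derivₛ q
  derivₛ-⋆ p q n = begin
    natK (suc n) • (p ⋆ q) (suc n)                                    ≈⟨ •-cong K.refl (⋆-coeff p q (suc n)) ⟩
    natK (suc n) • Σ< (suc (suc n)) X                                 ≈⟨ Σ<-• (suc (suc n)) _ X ⟩
    Σ< (suc (suc n)) (λ i → natK (suc n) • X i)                       ≈⟨ Σ<-cong-< (suc (suc n)) (λ i i<2+n → •-cong (split i (ℕ.≤-pred i<2+n)) refl) ⟩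
    Σ< (suc (suc n)) (λ i → (natK i K.+ natK (suc n ∸ i)) • X i)      ≈⟨ Σ<-cong (suc (suc n)) (λ i → •-distribʳ _ _ _) ⟩
    Σ< (suc (suc n)) (λ i → natK i • X i + natK (suc n ∸ i) • X i)    ≈⟨ Σ<-+ (suc (suc n)) _ _ ⟩
    Σ< (suc (suc n)) (λ i → natK i • X i) + Σ< (suc (suc n)) (λ i → natK (suc n ∸ i) • X i)
                                                                      ≈⟨ +-cong left-factor right-factor ⟩
    (derivₛ p ⋆ q) n + (p ⋆ derivₛ q) n                               ∎
    where
    X : ℕ → Carrier
    X i = p i * q (suc n ∸ i)
    split : ∀ i → i ≤ suc n → natK (suc n) K.≈ natK i K.+ natK (suc n ∸ i)
    split i i≤1+n = K.trans (K.reflexive (≡.cong natK (≡.sym (ℕ.m+[n∸m]≡n i≤1+n)))) (fromℕ-+ i (suc n ∸ i))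
    left-factor : Σ< (suc (suc n)) (λ i → natK i • X i) ≈ (derivₛ p ⋆ q) n
    left-factor = begin
      Σ< (suc (suc n)) (λ i → natK i • X i)                                        ≡⟨ Σ<-suc (suc n) _ ⟩
      natK 0 • X 0 + Σ< (suc n) (λ i → natK (suc i) • (p (suc i) * q (n ∸ i)))    ≈⟨ +-congʳ (trans (•-cong fromℕ-0 refl) (•-zeroˡ _)) ⟩
      0# + Σ< (suc n) (λ i → natK (suc i) • (p (suc i) * q (n ∸ i)))              ≈⟨ +-identityˡ _ ⟩
      Σ< (suc n) (λ i → natK (suc i) • (p (suc i) * q (n ∸ i)))                   ≈⟨ Σ<-cong (suc n) (λ i → •-*-assocˡ _ _ _) ⟨
      Σ< (suc n) (λ i → derivₛ p i * q (n ∸ i))                                   ≈⟨ ⋆-coeff (derivₛ p) q n ⟨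
      (derivₛ p ⋆ q) n                                                            ∎
    right-factor : Σ< (suc (suc n)) (λ i → natK (suc n ∸ i) • X i) ≈ (p ⋆ derivₛ q) n
    right-factor = begin
      Σ< (suc (suc n)) (λ i → natK (suc n ∸ i) • X i)                             ≈⟨ Σ<-last (suc n) _ ⟩
      Σ< (suc n) (λ i → natK (suc n ∸ i) • X i) + natK (n ∸ n) • X (suc n)        ≈⟨ +-congˡ (trans (•-cong last-weight refl) (•-zeroˡ _)) ⟩
      Σ< (suc n) (λ i → natK (suc n ∸ i) • X i) + 0#                              ≈⟨ +-identityʳ _ ⟩
      Σ< (suc n) (λ i → natK (suc n ∸ i) • X i)                                   ≈⟨ Σ<-cong-< (suc n) (λ i i<1+n → trans (sym (•-*-assocʳ _ _ _))
                                                                                       (reflexive (≡.cong (λ m → p i * (natK m • q m)) (ℕ.+-∸-assoc 1 (ℕ.≤-pred i<1+n))))) ⟩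
      Σ< (suc n) (λ i → p i * derivₛ q (n ∸ i))                                   ≈⟨ ⋆-coeff p (derivₛ q) n ⟨
      (p ⋆ derivₛ q) n                                                            ∎
      where
      last-weight : natK (n ∸ n) K.≈ K.0#
      last-weight = K.trans (K.reflexive (≡.cong natK (ℕ.n∸n≡0 n))) fromℕ-0

  ≈ₛ-by-induction : ∀ {p q} → p 0 ≈ q 0 → (∀ n → (∀ i → i ≤ n → p i ≈ q i) → p (suc n) ≈ q (suc n)) → p ≈ₛ q
  ≈ₛ-by-induction {p} {q} base step n = below n n ℕ.≤-refl
    where
    below : ∀ n i → i ≤ n → p i ≈ q i
    below zero    .0 z≤n = base
    below (suc n) i i≤1+n with ℕ.m≤n⇒m<n∨m≡n i≤1+n
    ... | inj₁ i<1+n  = below n i (ℕ.≤-pred i<1+n)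
    ... | inj₂ ≡.refl = step n (below n)

  derivₛ≈⋆ʳ-unique : ∀ {p q r} → derivₛ p ≈ₛ p ⋆ r → derivₛ q ≈ₛ q ⋆ r → p 0 ≈ q 0 → p ≈ₛ q
  derivₛ≈⋆ʳ-unique {p} {q} {r} p′≈pr q′≈qr p₀≈q₀ = ≈ₛ-by-induction p₀≈q₀ λ n p≈q → fromℕ[1+n]•-injective n (begin
    natK (suc n) • p (suc n)   ≈⟨ p′≈pr n ⟩
    (p ⋆ r) n                  ≈⟨ ⋆-coeff-cong {p} {q} {r} {r} n p≈q (λ _ _ → refl) ⟩
    (q ⋆ r) n                  ≈⟨ q′≈qr n ⟨
    natK (suc n) • q (suc n)   ∎)

  derivₛ≈⋆ˡ-unique : ∀ {p q r} → derivₛ p ≈ₛ r ⋆ p → derivₛ q ≈ₛ r ⋆ q → p 0 ≈ q 0 → p ≈ₛ q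
  derivₛ≈⋆ˡ-unique {p} {q} {r} p′≈rp q′≈rq p₀≈q₀ = ≈ₛ-by-induction p₀≈q₀ λ n p≈q → fromℕ[1+n]•-injective n (begin
    natK (suc n) • p (suc n)   ≈⟨ p′≈rp n ⟩
    (r ⋆ p) n                  ≈⟨ ⋆-coeff-cong {r} {r} {p} {q} n (λ _ _ → refl) p≈q ⟩
    (r ⋆ q) n                  ≈⟨ q′≈rq n ⟨
    natK (suc n) • q (suc n)   ∎)


module LogarithmicDerivatives {k kℓ a ℓ : Level} {K : QAlgebra k kℓ} (R : KAlgebra K a ℓ) where
  open KAlgebra R using (_≈_)
  open PowerSeries R
  open PowerSeriesAlgebra R
  private module S = Ring seriesRing
  open import Relation.Binary.Reasoning.Setoid S.setoid

  ≈ₛ⇔right-log-derivative-≈ₛ : ∀ {u p q r s} → u ⋆ p ≈ₛ oneₛ → p 0 ≈ q 0 →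
    derivₛ p ≈ₛ p ⋆ r → derivₛ q ≈ₛ q ⋆ s → (p ≈ₛ q ⇔ r ≈ₛ s)
  ≈ₛ⇔right-log-derivative-≈ₛ {u} {p} {q} {r} {s} up≈1 p₀≈q₀ p′≈pr q′≈qs = mk⇔ ⇒ ⇐
    where
    ⇐ : r ≈ₛ s → p ≈ₛ q
    ⇐ r≈s = derivₛ≈⋆ʳ-unique p′≈pr (S.trans q′≈qs (S.*-congˡ (S.sym r≈s))) p₀≈q₀
    ⇒ : p ≈ₛ q → r ≈ₛ s
    ⇒ p≈q = begin
      r                 ≈⟨ S.*-identityˡ r ⟨
      oneₛ ⋆ r          ≈⟨ S.*-congʳ up≈1 ⟨
      (u ⋆ p) ⋆ r       ≈⟨ S.*-assoc u p r ⟩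
      u ⋆ (p ⋆ r)       ≈⟨ S.*-congˡ p′≈pr ⟨
      u ⋆ derivₛ p      ≈⟨ S.*-congˡ (derivₛ-cong p≈q) ⟩
      u ⋆ derivₛ q      ≈⟨ S.*-congˡ q′≈qs ⟩
      u ⋆ (q ⋆ s)       ≈⟨ S.*-congˡ (S.*-congʳ p≈q) ⟨
      u ⋆ (p ⋆ s)       ≈⟨ S.*-assoc u p s ⟨
      (u ⋆ p) ⋆ s       ≈⟨ S.*-congʳ up≈1 ⟩
      oneₛ ⋆ s          ≈⟨ S.*-identityˡ s ⟩
      s                 ∎

  ≈ₛ⇔left-log-derivative-≈ₛ : ∀ {u p q r s} → p ⋆ u ≈ₛ oneₛ → p 0 ≈ q 0 →
    derivₛ p ≈ₛ r ⋆ p → derivₛ q ≈ₛ s ⋆ q → (p ≈ₛ q ⇔ r ≈ₛ s)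
  ≈ₛ⇔left-log-derivative-≈ₛ {u} {p} {q} {r} {s} pu≈1 p₀≈q₀ p′≈rp q′≈sq = mk⇔ ⇒ ⇐
    where
    ⇐ : r ≈ₛ s → p ≈ₛ q
    ⇐ r≈s = derivₛ≈⋆ˡ-unique p′≈rp (S.trans q′≈sq (S.*-congʳ (S.sym r≈s))) p₀≈q₀
    ⇒ : p ≈ₛ q → r ≈ₛ s
    ⇒ p≈q = begin
      r                 ≈⟨ S.*-identityʳ r ⟨
      r ⋆ oneₛ          ≈⟨ S.*-congˡ pu≈1 ⟨
      r ⋆ (p ⋆ u)       ≈⟨ S.*-assoc r p u ⟨
      (r ⋆ p) ⋆ u       ≈⟨ S.*-congʳ p′≈rp ⟨
      derivₛ p ⋆ u      ≈⟨ S.*-congʳ (derivₛ-cong p≈q) ⟩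
      derivₛ q ⋆ u      ≈⟨ S.*-congʳ q′≈sq ⟩
      (s ⋆ q) ⋆ u       ≈⟨ S.*-congʳ (S.*-congˡ p≈q) ⟨
      (s ⋆ p) ⋆ u       ≈⟨ S.*-assoc s p u ⟩
      s ⋆ (p ⋆ u)       ≈⟨ S.*-congˡ pu≈1 ⟩
      s ⋆ oneₛ          ≈⟨ S.*-identityʳ s ⟩
      s                 ∎

  derivₛ-⋆-right-log : ∀ {p q r s} → derivₛ p ≈ₛ p ⋆ r → derivₛ q ≈ₛ q ⋆ s → r ⋆ q ≈ₛ q ⋆ r →
    derivₛ (p ⋆ q) ≈ₛ (p ⋆ q) ⋆ (r +ₛ s)
  derivₛ-⋆-right-log {p} {q} {r} {s} p′≈pr q′≈qs rq≈qr = begin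
    derivₛ (p ⋆ q)                   ≈⟨ derivₛ-⋆ p q ⟩
    derivₛ p ⋆ q +ₛ p ⋆ derivₛ q     ≈⟨ S.+-cong (S.*-congʳ p′≈pr) (S.*-congˡ q′≈qs) ⟩
    (p ⋆ r) ⋆ q +ₛ p ⋆ (q ⋆ s)       ≈⟨ S.+-cong (S.*-assoc p r q) (S.sym (S.*-assoc p q s)) ⟩
    p ⋆ (r ⋆ q) +ₛ (p ⋆ q) ⋆ s       ≈⟨ S.+-congʳ (S.*-congˡ rq≈qr) ⟩
    p ⋆ (q ⋆ r) +ₛ (p ⋆ q) ⋆ s       ≈⟨ S.+-congʳ (S.*-assoc p q r) ⟨
    (p ⋆ q) ⋆ r +ₛ (p ⋆ q) ⋆ s       ≈⟨ S.distribˡ (p ⋆ q) r s ⟨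
    (p ⋆ q) ⋆ (r +ₛ s)               ∎

  derivₛ-⋆-left-log : ∀ {p q r s} → derivₛ p ≈ₛ r ⋆ p → derivₛ q ≈ₛ s ⋆ q → p ⋆ s ≈ₛ s ⋆ p →
    derivₛ (p ⋆ q) ≈ₛ (r +ₛ s) ⋆ (p ⋆ q)
  derivₛ-⋆-left-log {p} {q} {r} {s} p′≈rp q′≈sq ps≈sp = begin
    derivₛ (p ⋆ q)                   ≈⟨ derivₛ-⋆ p q ⟩
    derivₛ p ⋆ q +ₛ p ⋆ derivₛ q     ≈⟨ S.+-cong (S.*-congʳ p′≈rp) (S.*-congˡ q′≈sq) ⟩
    (r ⋆ p) ⋆ q +ₛ p ⋆ (s ⋆ q)       ≈⟨ S.+-cong (S.*-assoc r p q) (S.sym (S.*-assoc p s q)) ⟩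
    r ⋆ (p ⋆ q) +ₛ (p ⋆ s) ⋆ q       ≈⟨ S.+-congˡ (S.*-congʳ ps≈sp) ⟩
    r ⋆ (p ⋆ q) +ₛ (s ⋆ p) ⋆ q       ≈⟨ S.+-congˡ (S.*-assoc s p q) ⟩
    r ⋆ (p ⋆ q) +ₛ s ⋆ (p ⋆ q)       ≈⟨ S.distribʳ (p ⋆ q) r s ⟨
    (r +ₛ s) ⋆ (p ⋆ q)               ∎

module Reflection {k kℓ a ℓ : Level} {K : QAlgebra k kℓ} (R : KAlgebra K a ℓ) where
  open KAlgebra R
  open PowerSeries R
  open PowerSeriesAlgebra R
  open FiniteSums baseRing
  open Σ<-Homomorphism baseRing baseRing using (Σ<-homo)
  open import Algebra.Properties.Ring baseRing using (-0#≈0#; -‿+-comm; -‿involutive; -‿distribˡ-*; -‿distribʳ-*)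
  open import Relation.Binary.Reasoning.Setoid setoid

  altSign-cong : ∀ n {u v} → u ≈ v → altSign n u ≈ altSign n v
  altSign-cong zero    u≈v = u≈v
  altSign-cong (suc n) u≈v = -‿cong (altSign-cong n u≈v)

  altSign-0 : ∀ n → altSign n 0# ≈ 0#
  altSign-0 zero    = refl
  altSign-0 (suc n) = trans (-‿cong (altSign-0 n)) -0#≈0#

  altSign-+ : ∀ n u v → altSign n (u + v) ≈ altSign n u + altSign n v
  altSign-+ zero    u v = refl
  altSign-+ (suc n) u v = trans (-‿cong (altSign-+ n u v)) (sym (-‿+-comm _ _))

  altSign-- : ∀ n u → altSign n (- u) ≈ - altSign n u
  altSign-- zero    u = refl
  altSign-- (suc n) u = -‿cong (altSign-- n u)

  altSign-involutive : ∀ n u → altSign n (altSign n u) ≈ u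
  altSign-involutive zero    u = refl
  altSign-involutive (suc n) u = begin
    - altSign n (- altSign n u)     ≈⟨ -‿cong (altSign-- n _) ⟩
    - - altSign n (altSign n u)     ≈⟨ -‿involutive _ ⟩
    altSign n (altSign n u)         ≈⟨ altSign-involutive n u ⟩
    u                               ∎

  altSign-*ʳ : ∀ n u v → altSign n (u * v) ≈ u * altSign n v
  altSign-*ʳ zero    u v = refl
  altSign-*ʳ (suc n) u v = trans (-‿cong (altSign-*ʳ n u v)) (-‿distribʳ-* _ _)

  altSign-* : ∀ m n u v → altSign (m ℕ.+ n) (u * v) ≈ altSign m u * altSign n v
  altSign-* zero    n u v = altSign-*ʳ n u v
  altSign-* (suc m) n u v = trans (-‿cong (altSign-* m n u v)) (-‿distribˡ-* _ _)

  reflectₛ-⋆ : ∀ p q → reflectₛ (p ⋆ q) ≈ₛ reflectₛ p ⋆ reflectₛ q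
  reflectₛ-⋆ p q n = begin
    altSign n ((p ⋆ q) n)                                      ≈⟨ altSign-cong n (⋆-coeff p q n) ⟩
    altSign n (Σ< (suc n) (λ i → p i * q (n ∸ i)))             ≈⟨ Σ<-homo (altSign n) (altSign-cong n) (altSign-0 n) (altSign-+ n) (suc n) _ ⟩
    Σ< (suc n) (λ i → altSign n (p i * q (n ∸ i)))             ≈⟨ Σ<-cong-< (suc n) (λ i i<1+n → trans
      (reflexive (≡.cong (λ m → altSign m (p i * q (n ∸ i))) (≡.sym (ℕ.m+[n∸m]≡n (ℕ.≤-pred i<1+n))))) (altSign-* i (n ∸ i) _ _)) ⟩
    Σ< (suc n) (λ i → reflectₛ p i * reflectₛ q (n ∸ i))       ≈⟨ ⋆-coeff (reflectₛ p) (reflectₛ q) n ⟨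
    (reflectₛ p ⋆ reflectₛ q) n                                ∎

  ≈ₛ⇔reflectₛ-≈ₛ : ∀ {p q} → p ≈ₛ q ⇔ reflectₛ p ≈ₛ reflectₛ q
  ≈ₛ⇔reflectₛ-≈ₛ {p} {q} = mk⇔ (λ p≈q n → altSign-cong n (p≈q n)) λ p̃≈q̃ n → begin
    p n                            ≈⟨ altSign-involutive n (p n) ⟨
    altSign n (altSign n (p n))    ≈⟨ altSign-cong n (p̃≈q̃ n) ⟩
    altSign n (altSign n (q n))    ≈⟨ altSign-involutive n (q n) ⟩
    q n                            ∎

module Exponential {k kℓ a ℓ : Level} {K : QAlgebra k kℓ} (R : KAlgebra K a ℓ) where
  private module K = QAlgebra K
  open KAlgebra R
  open PowerSeries R
  open PowerSeriesAlgebra R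
  open FiniteSums baseRing
  open KAlgebraProperties R using (•-zeroʳ)
  open IsRingHomomorphism K.fromℚ-isRingHomomorphism using (1#-homo)
  open import Relation.Binary.Reasoning.Setoid setoid

  expₛ-0 : ∀ d → expₛ d 0 ≈ 1#
  expₛ-0 d = trans (+-identityʳ _) (trans (•-cong 1#-homo refl) (•-identity _))

  powₛ-coeff-cong : ∀ {p q} n → (∀ j → j ≤ n → p j ≈ q j) → ∀ i m → m ≤ n → powₛ p i m ≈ powₛ q i m
  powₛ-coeff-cong n p≈q zero    m m≤n = refl
  powₛ-coeff-cong {p} {q} n p≈q (suc i) m m≤n = ⋆-coeff-cong {p} {q} {powₛ p i} {powₛ q i} m
    (λ j j≤m → p≈q j (ℕ.≤-trans j≤m m≤n)) (λ j j≤m → powₛ-coeff-cong n p≈q i j (ℕ.≤-trans j≤m m≤n))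

  powₛ[2+i]-coeff-cong : ∀ {p q} n → p 0 ≈ 0# → q 0 ≈ 0# → (∀ j → j ≤ n → p j ≈ q j) →
    ∀ i → powₛ p (2 ℕ.+ i) (suc n) ≈ powₛ q (2 ℕ.+ i) (suc n)
  powₛ[2+i]-coeff-cong {p} {q} n p₀≈0 q₀≈0 p≈q i = begin
    (p ⋆ powₛ p (suc i)) (suc n)                            ≈⟨ ⋆-coeff p (powₛ p (suc i)) (suc n) ⟩
    Σ< (suc (suc n)) (λ j → p j * powₛ p (suc i) (suc n ∸ j)) ≈⟨ Σ<-cong-< (suc (suc n)) term-cong ⟩
    Σ< (suc (suc n)) (λ j → q j * powₛ q (suc i) (suc n ∸ j)) ≈⟨ ⋆-coeff q (powₛ q (suc i)) (suc n) ⟨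
    (q ⋆ powₛ q (suc i)) (suc n)                            ∎
    where
    last≈0 : ∀ {r} → r 0 ≈ 0# → powₛ r (suc i) (n ∸ n) ≈ 0#
    last≈0 r₀≈0 = trans (reflexive (≡.cong (powₛ _ (suc i)) (ℕ.n∸n≡0 n))) (powₛ-order r₀≈0 (suc i) 0 (s≤s z≤n))
    term-cong : ∀ j → j < suc (suc n) → p j * powₛ p (suc i) (suc n ∸ j) ≈ q j * powₛ q (suc i) (suc n ∸ j)
    term-cong zero    _ = trans (*-congʳ p₀≈0) (trans (zeroˡ _) (sym (trans (*-congʳ q₀≈0) (zeroˡ _))))
    term-cong (suc j) 1+j<2+n with ℕ.m≤n⇒m<n∨m≡n (ℕ.≤-pred (ℕ.≤-pred 1+j<2+n))
    ... | inj₁ j<n    = *-cong (p≈q (suc j) j<n) (powₛ-coeff-cong n p≈q (suc i) (n ∸ j) (ℕ.m∸n≤m n j))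
    ... | inj₂ ≡.refl = trans (*-congˡ (last≈0 p₀≈0)) (trans (zeroʳ _) (sym (trans (*-congˡ (last≈0 q₀≈0)) (zeroʳ _))))

  expₛ-cong : ∀ {p q} → p ≈ₛ q → expₛ p ≈ₛ expₛ q
  expₛ-cong {p} {q} p≈q n = begin
    expₛ p n                                              ≈⟨ Σ≤≈Σ< n _ ⟩
    Σ< (suc n) (λ i → inv! i • powₛ p i n)                ≈⟨ Σ<-cong (suc n) (λ i → •-cong K.refl (powₛ-coeff-cong n (λ j _ → p≈q j) i n ℕ.≤-refl)) ⟩
    Σ< (suc n) (λ i → inv! i • powₛ q i n)                ≈⟨ Σ≤≈Σ< n _ ⟨
    expₛ q n                                              ∎

  -- the coefficient of t^(n+1) in exp p is p (n+1) plus terms of p^(2+i), which only involve p 0, …, p n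
  expₛ-injective : ∀ {p q} → p 0 ≈ 0# → q 0 ≈ 0# → expₛ p ≈ₛ expₛ q → p ≈ₛ q
  expₛ-injective {p} {q} p₀≈0 q₀≈0 eᵖ≈eᵠ = ≈ₛ-by-induction (trans p₀≈0 (sym q₀≈0)) λ n p≈q →
    +-cancelʳ (higher p n) (p (suc n)) (q (suc n)) (begin
      p (suc n) + higher p n     ≈⟨ expₛ-coeff p n ⟨
      expₛ p (suc n)             ≈⟨ eᵖ≈eᵠ (suc n) ⟩
      expₛ q (suc n)             ≈⟨ expₛ-coeff q n ⟩
      q (suc n) + higher q n     ≈⟨ +-congˡ (Σ<-cong n (λ i → •-cong K.refl (powₛ[2+i]-coeff-cong n q₀≈0 p₀≈0 (λ j j≤n → sym (p≈q j j≤n)) i))) ⟩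
      q (suc n) + higher p n     ∎)
    where
    open import Algebra.Properties.Ring baseRing using (+-cancelʳ)
    higher : Series → ℕ → Carrier
    higher r n = Σ< n (λ i → inv! (2 ℕ.+ i) • powₛ r (2 ℕ.+ i) (suc n))
    expₛ-coeff : ∀ r n → expₛ r (suc n) ≈ r (suc n) + higher r n
    expₛ-coeff r n = begin
      expₛ r (suc n)                                                  ≈⟨ Σ≤≈Σ< (suc n) _ ⟩
      Σ< (suc (suc n)) (λ i → inv! i • powₛ r i (suc n))              ≡⟨ Σ<-suc (suc n) _ ⟩
      inv! 0 • 0# + Σ< (suc n) (λ i → inv! (suc i) • powₛ r (suc i) (suc n))
                                                                      ≈⟨ +-congʳ (•-zeroʳ _) ⟩
      0# + Σ< (suc n) (λ i → inv! (suc i) • powₛ r (suc i) (suc n))  ≈⟨ +-identityˡ _ ⟩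
      Σ< (suc n) (λ i → inv! (suc i) • powₛ r (suc i) (suc n))        ≡⟨ Σ<-suc n _ ⟩
      inv! 1 • powₛ r 1 (suc n) + higher r n                          ≈⟨ +-congʳ (trans (•-cong 1#-homo (⋆-identityʳ r (suc n))) (•-identity _)) ⟩
      r (suc n) + higher r n                                          ∎

  ≈ₛ⇔expₛ-≈ₛ : ∀ {p q} → p 0 ≈ 0# → q 0 ≈ 0# → (p ≈ₛ q ⇔ expₛ p ≈ₛ expₛ q)
  ≈ₛ⇔expₛ-≈ₛ p₀≈0 q₀≈0 = mk⇔ expₛ-cong (expₛ-injective p₀≈0 q₀≈0)

record KAlgebraHomomorphism {k kℓ a ℓ b m : Level} {K : QAlgebra k kℓ} (R : KAlgebra K a ℓ) (S : KAlgebra K b m)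
                            : Set (k ⊔ a ⊔ ℓ ⊔ b ⊔ m) where
  private
    module R = KAlgebra R
    module S = KAlgebra S
  field
    ⟦_⟧     : R.Carrier → S.Carrier
    ⟦⟧-cong : ∀ {u v} → u R.≈ v → ⟦ u ⟧ S.≈ ⟦ v ⟧
    +-homo  : ∀ u v → ⟦ u R.+ v ⟧ S.≈ ⟦ u ⟧ S.+ ⟦ v ⟧
    *-homo  : ∀ u v → ⟦ u R.* v ⟧ S.≈ ⟦ u ⟧ S.* ⟦ v ⟧
    •-homo  : ∀ x u → ⟦ x R.• u ⟧ S.≈ x S.• ⟦ u ⟧
    1#-homo : ⟦ R.1# ⟧ S.≈ S.1#

module SeriesHomomorphism {k kℓ a ℓ b m : Level} {K : QAlgebra k kℓ} {R : KAlgebra K a ℓ} {S : KAlgebra K b m}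
                          (H : KAlgebraHomomorphism R S) where
  private
    module R = KAlgebra R
    module S = KAlgebra S
    module PR = PowerSeries R
    module PS = PowerSeries S
    module ΣR = FiniteSums R.baseRing
    module ΣS = FiniteSums S.baseRing
    module SR = PowerSeriesAlgebra R
    module SS = PowerSeriesAlgebra S
  open KAlgebraHomomorphism H
  open Σ<-Homomorphism R.baseRing S.baseRing using (Σ<-homo)
  open import Algebra.Properties.Ring S.baseRing using (x+x≈x⇒x≈0; +-inverseʳ-unique)
  open import Relation.Binary.Reasoning.Setoid S.setoid

  0#-homo : ⟦ R.0# ⟧ S.≈ S.0#
  0#-homo = x+x≈x⇒x≈0 ⟦ R.0# ⟧ (S.trans (S.sym (+-homo R.0# R.0#)) (⟦⟧-cong (R.+-identityʳ R.0#)))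

  -‿homo : ∀ u → ⟦ R.- u ⟧ S.≈ S.- ⟦ u ⟧
  -‿homo u = +-inverseʳ-unique ⟦ u ⟧ ⟦ R.- u ⟧ (S.trans (S.sym (+-homo u (R.- u))) (S.trans (⟦⟧-cong (R.-‿inverseʳ u)) 0#-homo))

  ⟦⟧-≈0 : ∀ {u} → u R.≈ R.0# → ⟦ u ⟧ S.≈ S.0#
  ⟦⟧-≈0 u≈0 = S.trans (⟦⟧-cong u≈0) 0#-homo

  mapₛ : PR.Series → PS.Series
  mapₛ p n = ⟦ p n ⟧

  mapₛ-cong : ∀ {p q} → p PR.≈ₛ q → mapₛ p PS.≈ₛ mapₛ q
  mapₛ-cong p≈q n = ⟦⟧-cong (p≈q n)

  mapₛ-⋆ : ∀ p q → mapₛ (p PR.⋆ q) PS.≈ₛ mapₛ p PS.⋆ mapₛ q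
  mapₛ-⋆ p q n = begin
    ⟦ (p PR.⋆ q) n ⟧                                           ≈⟨ ⟦⟧-cong (SR.⋆-coeff p q n) ⟩
    ⟦ ΣR.Σ< (suc n) (λ i → p i R.* q (n ∸ i)) ⟧                ≈⟨ Σ<-homo ⟦_⟧ ⟦⟧-cong 0#-homo +-homo (suc n) _ ⟩
    ΣS.Σ< (suc n) (λ i → ⟦ p i R.* q (n ∸ i) ⟧)                ≈⟨ ΣS.Σ<-cong (suc n) (λ i → *-homo _ _) ⟩
    ΣS.Σ< (suc n) (λ i → ⟦ p i ⟧ S.* ⟦ q (n ∸ i) ⟧)            ≈⟨ SS.⋆-coeff (mapₛ p) (mapₛ q) n ⟨
    (mapₛ p PS.⋆ mapₛ q) n                                     ∎

  mapₛ-oneₛ : mapₛ PR.oneₛ PS.≈ₛ PS.oneₛ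
  mapₛ-oneₛ zero    = 1#-homo
  mapₛ-oneₛ (suc n) = 0#-homo

  mapₛ-⋆≈oneₛ : ∀ {p q} → p PR.⋆ q PR.≈ₛ PR.oneₛ → mapₛ p PS.⋆ mapₛ q PS.≈ₛ PS.oneₛ
  mapₛ-⋆≈oneₛ {p} {q} pq≈1 n = S.trans (S.sym (mapₛ-⋆ p q n)) (S.trans (⟦⟧-cong (pq≈1 n)) (mapₛ-oneₛ n))

  mapₛ-powₛ : ∀ p i → mapₛ (PR.powₛ p i) PS.≈ₛ PS.powₛ (mapₛ p) i
  mapₛ-powₛ p zero    = mapₛ-oneₛ
  mapₛ-powₛ p (suc i) n = S.trans (mapₛ-⋆ p (PR.powₛ p i) n) (SS.⋆-cong {mapₛ p} (λ _ → S.refl) (mapₛ-powₛ p i) n)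

  mapₛ-expₛ : ∀ p → mapₛ (PR.expₛ p) PS.≈ₛ PS.expₛ (mapₛ p)
  mapₛ-expₛ p n = begin
    ⟦ PR.expₛ p n ⟧                                                  ≈⟨ ⟦⟧-cong (SR.Σ≤≈Σ< n _) ⟩
    ⟦ ΣR.Σ< (suc n) (λ i → PR.inv! i R.• PR.powₛ p i n) ⟧            ≈⟨ Σ<-homo ⟦_⟧ ⟦⟧-cong 0#-homo +-homo (suc n) _ ⟩
    ΣS.Σ< (suc n) (λ i → ⟦ PR.inv! i R.• PR.powₛ p i n ⟧)            ≈⟨ ΣS.Σ<-cong (suc n) (λ i → S.trans (•-homo _ _) (S.•-cong (QAlgebra.refl K) (mapₛ-powₛ p i n))) ⟩
    ΣS.Σ< (suc n) (λ i → PS.inv! i S.• PS.powₛ (mapₛ p) i n)         ≈⟨ SS.Σ≤≈Σ< n _ ⟨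
    PS.expₛ (mapₛ p) n                                               ∎

  mapₛ-derivₛ : ∀ p → mapₛ (PR.derivₛ p) PS.≈ₛ PS.derivₛ (mapₛ p)
  mapₛ-derivₛ p n = •-homo _ _

  mapₛ-derivₛ≈⋆ʳ : ∀ {p r} → PR.derivₛ p PR.≈ₛ p PR.⋆ r → PS.derivₛ (mapₛ p) PS.≈ₛ mapₛ p PS.⋆ mapₛ r
  mapₛ-derivₛ≈⋆ʳ {p} {r} p′≈pr n = S.trans (S.sym (mapₛ-derivₛ p n)) (S.trans (⟦⟧-cong (p′≈pr n)) (mapₛ-⋆ p r n))

  mapₛ-derivₛ≈⋆ˡ : ∀ {p r} → PR.derivₛ p PR.≈ₛ r PR.⋆ p → PS.derivₛ (mapₛ p) PS.≈ₛ mapₛ r PS.⋆ mapₛ p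
  mapₛ-derivₛ≈⋆ˡ {p} {r} p′≈rp n = S.trans (S.sym (mapₛ-derivₛ p n)) (S.trans (⟦⟧-cong (p′≈rp n)) (mapₛ-⋆ r p n))

  mapₛ-reflectₛ : ∀ p → mapₛ (PR.reflectₛ p) PS.≈ₛ PS.reflectₛ (mapₛ p)
  mapₛ-reflectₛ p n = altSign-homo n (p n)
    where
    altSign-homo : ∀ n u → ⟦ PR.altSign n u ⟧ S.≈ PS.altSign n ⟦ u ⟧
    altSign-homo zero    u = S.refl
    altSign-homo (suc n) u = S.trans (-‿homo _) (S.-‿cong (altSign-homo n u))

module ExponentialOfSum {k kℓ a ℓ : Level} {K : QAlgebra k kℓ} (R : KAlgebra K a ℓ) where
  private
    module K = QAlgebra K
    module R = KAlgebra R
    module PR = PowerSeries R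
    module ΣR = FiniteSums R.baseRing
    module SR = PowerSeriesAlgebra R
    S : KAlgebra K a ℓ
    S = SR.seriesAlgebra
    module S = KAlgebra S
    module PS = PowerSeries S
    module ΣS = FiniteSums S.baseRing
    module SS = PowerSeriesAlgebra S
  open QAlgebraArithmetic K using ([1+i]*1/[1+i]!≈1/i!)
  open IsRingHomomorphism K.fromℚ-isRingHomomorphism using (1#-homo)

  -- exp(s·p(t)) as a power series in s over R[[t]]
  expₛ[s·_] : PR.Series → PS.Series
  expₛ[s· p ] i = PR.inv! i SR.•ₛ PR.powₛ p i

  constantₛ : PR.Series → PS.Series
  constantₛ p zero    = p
  constantₛ p (suc _) = SR.0ₛ

  module _ where
    open import Relation.Binary.Reasoning.Setoid S.setoid

    constantₛ-⋆ : ∀ p E i → (constantₛ p PS.⋆ E) i S.≈ p PR.⋆ E i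
    constantₛ-⋆ p E i = begin
      (constantₛ p PS.⋆ E) i                                          ≈⟨ SS.⋆-coeff (constantₛ p) E i ⟩
      ΣS.Σ< (suc i) (λ j → constantₛ p j PR.⋆ E (i ∸ j))              ≡⟨ ΣS.Σ<-suc i _ ⟩
      p PR.⋆ E i S.+ ΣS.Σ< i (λ j → SR.0ₛ PR.⋆ E (i ∸ suc j))         ≈⟨ S.+-congˡ (ΣS.Σ<-zeros i (λ j _ → S.zeroˡ _)) ⟩
      p PR.⋆ E i S.+ SR.0ₛ                                            ≈⟨ S.+-identityʳ _ ⟩
      p PR.⋆ E i                                                      ∎

    derivₛ-expₛ[s·] : ∀ p → PS.derivₛ expₛ[s· p ] PS.≈ₛ constantₛ p PS.⋆ expₛ[s· p ]
    derivₛ-expₛ[s·] p i = begin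
      PR.natK (suc i) S.• (PR.inv! (suc i) S.• PR.powₛ p (suc i))   ≈⟨ S.•-assoc _ _ _ ⟨
      (PR.natK (suc i) K.* PR.inv! (suc i)) S.• PR.powₛ p (suc i)   ≈⟨ S.•-cong ([1+i]*1/[1+i]!≈1/i! i) S.refl ⟩
      PR.inv! i S.• (p PR.⋆ PR.powₛ p i)                            ≈⟨ S.•-*-assocʳ _ _ _ ⟨
      p PR.⋆ expₛ[s· p ] i                                          ≈⟨ constantₛ-⋆ p expₛ[s· p ] i ⟨
      (constantₛ p PS.⋆ expₛ[s· p ]) i                              ∎

    powₛ-comm : ∀ p q → p PR.⋆ q S.≈ q PR.⋆ p → ∀ i → PR.powₛ p i PR.⋆ q S.≈ q PR.⋆ PR.powₛ p i
    powₛ-comm p q pq≈qp zero    = S.trans (S.*-identityˡ q) (S.sym (S.*-identityʳ q))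
    powₛ-comm p q pq≈qp (suc i) = begin
      (p PR.⋆ PR.powₛ p i) PR.⋆ q   ≈⟨ S.*-assoc _ _ _ ⟩
      p PR.⋆ (PR.powₛ p i PR.⋆ q)   ≈⟨ S.*-congˡ (powₛ-comm p q pq≈qp i) ⟩
      p PR.⋆ (q PR.⋆ PR.powₛ p i)   ≈⟨ S.*-assoc _ _ _ ⟨
      (p PR.⋆ q) PR.⋆ PR.powₛ p i   ≈⟨ S.*-congʳ pq≈qp ⟩
      (q PR.⋆ p) PR.⋆ PR.powₛ p i   ≈⟨ S.*-assoc _ _ _ ⟩
      q PR.⋆ (p PR.⋆ PR.powₛ p i)   ∎

    expₛ[s·]-constantₛ-comm : ∀ p q → p PR.⋆ q S.≈ q PR.⋆ p → ∀ i j → expₛ[s· p ] i PR.⋆ constantₛ q j S.≈ constantₛ q j PR.⋆ expₛ[s· p ] i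
    expₛ[s·]-constantₛ-comm p q pq≈qp i zero = begin
      expₛ[s· p ] i PR.⋆ q                      ≈⟨ SR.⋆-•ˡ _ _ _ ⟩
      PR.inv! i S.• (PR.powₛ p i PR.⋆ q)        ≈⟨ S.•-cong K.refl (powₛ-comm p q pq≈qp i) ⟩
      PR.inv! i S.• (q PR.⋆ PR.powₛ p i)        ≈⟨ SR.⋆-•ʳ _ _ _ ⟨
      q PR.⋆ expₛ[s· p ] i                      ∎
    expₛ[s·]-constantₛ-comm p q pq≈qp i (suc j) = S.trans (S.zeroʳ _) (S.sym (S.zeroˡ _))

  module _ where
    private module 𝕊 = Ring SS.seriesRing
    open import Relation.Binary.Reasoning.Setoid 𝕊.setoid
    open LogarithmicDerivatives S using (derivₛ-⋆-left-log)

    expₛ[s·]-+ : ∀ p q → p PR.⋆ q S.≈ q PR.⋆ p → expₛ[s· p SR.+ₛ q ] PS.≈ₛ expₛ[s· p ] PS.⋆ expₛ[s· q ]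
    expₛ[s·]-+ p q pq≈qp = SS.derivₛ≈⋆ˡ-unique (derivₛ-expₛ[s·] (p SR.+ₛ q)) product′ (S.trans (e₀ (p SR.+ₛ q)) (S.sym product₀))
      where
      e₀ : ∀ r → expₛ[s· r ] 0 S.≈ PR.oneₛ
      e₀ r = S.trans (S.•-cong 1#-homo S.refl) (S.•-identity _)
      product₀ : (expₛ[s· p ] PS.⋆ expₛ[s· q ]) 0 S.≈ PR.oneₛ
      product₀ = S.trans (SS.⋆-coeff-0 expₛ[s· p ] expₛ[s· q ]) (S.trans (S.*-cong (e₀ p) (e₀ q)) (S.*-identityˡ _))
      constantₛ-+ : constantₛ p SS.+ₛ constantₛ q PS.≈ₛ constantₛ (p SR.+ₛ q)
      constantₛ-+ zero    = S.refl
      constantₛ-+ (suc i) = S.+-identityʳ _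
      product′ : PS.derivₛ (expₛ[s· p ] PS.⋆ expₛ[s· q ]) PS.≈ₛ constantₛ (p SR.+ₛ q) PS.⋆ (expₛ[s· p ] PS.⋆ expₛ[s· q ])
      product′ = 𝕊.trans (derivₛ-⋆-left-log (derivₛ-expₛ[s·] p) (derivₛ-expₛ[s·] q)
                   (SS.⋆-comm expₛ[s· p ] (constantₛ q) (expₛ[s·]-constantₛ-comm p q pq≈qp)))
                 (𝕊.*-congʳ constantₛ-+)

  -- a filtered series in s can be evaluated at s = 1: each t-coefficient then gets finitely many contributions
  IsFiltered : PS.Series → Set ℓ
  IsFiltered E = ∀ i → SR.OrderAtLeast (E i) i

  eval₁ : PS.Series → PR.Series
  eval₁ E n = ΣR.Σ< (suc n) (λ i → E i n)

  module _ where
    open R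
    open ΣR
    open import Relation.Binary.Reasoning.Setoid R.setoid
    open Σ<-Homomorphism SR.seriesRing R.baseRing using (Σ<-homo)
    open KAlgebraProperties R using (•-zeroʳ)

    Σ<-coeff : ∀ m (F : ℕ → PR.Series) n → ΣS.Σ< m F n ≈ Σ< m (λ j → F j n)
    Σ<-coeff m F n = Σ<-homo (λ p → p n) (λ p≈q → p≈q n) refl (λ _ _ → refl) m F

    expₛ[s·]-filtered : ∀ {p} → p 0 ≈ 0# → IsFiltered expₛ[s· p ]
    expₛ[s·]-filtered p₀≈0 i n n<i = trans (•-cong K.refl (SR.powₛ-order p₀≈0 i n n<i)) (•-zeroʳ _)

    eval₁-extend : ∀ {E} → IsFiltered E → ∀ {j n} → j ≤ n → eval₁ E j ≈ Σ< (suc n) (λ i → E i j)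
    eval₁-extend {E} E-filtered {j} j≤n = Σ<-extend (λ i → E i j) (s≤s j≤n) (λ i j<i _ → E-filtered i j j<i)

    eval₁-⋆ : ∀ {E F} → IsFiltered E → IsFiltered F → eval₁ (E PS.⋆ F) PR.≈ₛ eval₁ E PR.⋆ eval₁ F
    eval₁-⋆ {E} {F} E-filtered F-filtered n = begin
      Σ< (suc n) (λ i → (E PS.⋆ F) i n)
        ≈⟨ Σ<-cong (suc n) (λ i → trans (SS.⋆-coeff E F i n) (Σ<-coeff (suc i) (λ p → E p PR.⋆ F (i ∸ p)) n)) ⟩
      Σ< (suc n) (λ i → Σ< (suc i) (λ p → G p (i ∸ p)))
        ≈⟨ Σ<-triangle n G ⟩
      Σ< (suc n) (λ p → Σ< (suc (n ∸ p)) (G p))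
        ≈⟨ Σ<-cong-< (suc n) (λ p p<1+n → Σ<-extend (G p) (s≤s (ℕ.m∸n≤m n p)) (λ q n∸p<q _ →
             SR.⋆-order (E-filtered p) (F-filtered q) n (ℕ.≤-<-trans (ℕ.≤-reflexive (≡.sym (ℕ.m+[n∸m]≡n (ℕ.≤-pred p<1+n)))) (ℕ.+-monoʳ-< p n∸p<q)))) ⟩
      Σ< (suc n) (λ p → Σ< (suc n) (G p))
        ≈⟨ Σ<-cong (suc n) (λ p → Σ<-cong (suc n) (λ q → SR.⋆-coeff (E p) (F q) n)) ⟩
      Σ< (suc n) (λ p → Σ< (suc n) (λ q → Σ< (suc n) (λ j → H p q j)))
        ≈⟨ Σ<-cong (suc n) (λ p → Σ<-swap (suc n) (suc n) (H p)) ⟩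
      Σ< (suc n) (λ p → Σ< (suc n) (λ j → Σ< (suc n) (λ q → H p q j)))
        ≈⟨ Σ<-swap (suc n) (suc n) (λ p j → Σ< (suc n) (λ q → H p q j)) ⟩
      Σ< (suc n) (λ j → Σ< (suc n) (λ p → Σ< (suc n) (λ q → H p q j)))
        ≈⟨ Σ<-cong (suc n) (λ j → Σ<-*-Σ< (suc n) (suc n) (λ p → E p j) (λ q → F q (n ∸ j))) ⟨
      Σ< (suc n) (λ j → Σ< (suc n) (λ p → E p j) * Σ< (suc n) (λ q → F q (n ∸ j)))
        ≈⟨ Σ<-cong-< (suc n) (λ j j<1+n → *-cong (eval₁-extend E-filtered (ℕ.≤-pred j<1+n)) (eval₁-extend F-filtered (ℕ.m∸n≤m n j))) ⟨
      Σ< (suc n) (λ j → eval₁ E j * eval₁ F (n ∸ j))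
        ≈⟨ SR.⋆-coeff (eval₁ E) (eval₁ F) n ⟨
      (eval₁ E PR.⋆ eval₁ F) n
        ∎
      where
      G : ℕ → ℕ → Carrier
      G p q = (E p PR.⋆ F q) n
      H : ℕ → ℕ → ℕ → Carrier
      H p q j = E p j * F q (n ∸ j)

  module _ where
    private module 𝕊 = Ring SR.seriesRing
    open import Relation.Binary.Reasoning.Setoid 𝕊.setoid

    expₛ-+ : ∀ {p q} → p 0 R.≈ R.0# → q 0 R.≈ R.0# → p PR.⋆ q PR.≈ₛ q PR.⋆ p →
             PR.expₛ (p SR.+ₛ q) PR.≈ₛ PR.expₛ p PR.⋆ PR.expₛ q
    expₛ-+ {p} {q} p₀≈0 q₀≈0 pq≈qp = begin
      PR.expₛ (p SR.+ₛ q)                           ≈⟨ (λ n → SR.Σ≤≈Σ< n _) ⟩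
      eval₁ expₛ[s· p SR.+ₛ q ]                     ≈⟨ (λ n → ΣR.Σ<-cong (suc n) (λ i → expₛ[s·]-+ p q pq≈qp i n)) ⟩
      eval₁ (expₛ[s· p ] PS.⋆ expₛ[s· q ])          ≈⟨ eval₁-⋆ (expₛ[s·]-filtered p₀≈0) (expₛ[s·]-filtered q₀≈0) ⟩
      eval₁ expₛ[s· p ] PR.⋆ eval₁ expₛ[s· q ]      ≈⟨ 𝕊.*-cong (λ n → SR.Σ≤≈Σ< n _) (λ n → SR.Σ≤≈Σ< n _) ⟨
      PR.expₛ p PR.⋆ PR.expₛ q                      ∎

module TensorSquare {k kℓ a ℓ : Level} {K : QAlgebra k kℓ} (A : KAlgebra K a ℓ) where
  private
    module K = QAlgebra K
    module A = KAlgebra A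
  open Tensors A
  open import Algebra.Properties.Ring A.baseRing using (-‿distribʳ-*)

  ≡⇒≈⊗ : ∀ {xs ys} → xs ≡ ys → xs ≈⊗ ys
  ≡⇒≈⊗ ≡.refl = ⊗-refl

  ⊗-+-commutativeMonoid : CommutativeMonoid a (k ⊔ a ⊔ ℓ)
  ⊗-+-commutativeMonoid = record
    { Carrier = T₂ ; _≈_ = _≈⊗_ ; _∙_ = _++_ ; ε = []
    ; isCommutativeMonoid = record
      { isMonoid = record
        { isSemigroup = record
          { isMagma = record
            { isEquivalence = record { refl = ⊗-refl ; sym = ⊗-sym ; trans = ⊗-trans }
            ; ∙-cong = ⊗-++-cong }
          ; assoc = λ xs ys zs → ≡⇒≈⊗ (L.++-assoc xs ys zs) }
        ; identity = (λ _ → ⊗-refl) , (λ xs → ≡⇒≈⊗ (L.++-identityʳ xs)) }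
      ; comm = ⊗-++-comm } }

  open CommutativeMonoid ⊗-+-commutativeMonoid using (setoid; ∙-congˡ; ∙-congʳ) renaming (assoc to ++-assoc)
  open import Algebra.Properties.CommutativeSemigroup (CommutativeMonoid.commutativeSemigroup ⊗-+-commutativeMonoid) using (interchange)
  open import Relation.Binary.Reasoning.Setoid setoid

  Pair : Set a
  Pair = A.Carrier × A.Carrier

  map-cong⊗ : ∀ {i} {I : Set i} {f g : I → Pair} xs → (∀ x → [ f x ] ≈⊗ [ g x ]) → map f xs ≈⊗ map g xs
  map-cong⊗ []       f≈g = ⊗-refl
  map-cong⊗ (x ∷ xs) f≈g = ⊗-++-cong (f≈g x) (map-cong⊗ xs f≈g)

  map-zeros⊗ : ∀ {f : Pair → Pair} xs → (∀ x → [ f x ] ≈⊗ []) → map f xs ≈⊗ []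
  map-zeros⊗ []       f≈0 = ⊗-refl
  map-zeros⊗ (x ∷ xs) f≈0 = ⊗-++-cong (f≈0 x) (map-zeros⊗ xs f≈0)

  map-split⊗ : ∀ {f g h : Pair → Pair} xs → (∀ x → [ h x ] ≈⊗ f x ∷ g x ∷ []) → map h xs ≈⊗ map f xs ++ map g xs
  map-split⊗ []                 h≈f+g = ⊗-refl
  map-split⊗ {f} {g} {h} (x ∷ xs) h≈f+g = begin
    [ h x ] ++ map h xs                               ≈⟨ ⊗-++-cong (h≈f+g x) (map-split⊗ xs h≈f+g) ⟩
    ([ f x ] ++ [ g x ]) ++ (map f xs ++ map g xs)    ≈⟨ interchange [ f x ] [ g x ] (map f xs) (map g xs) ⟩
    ([ f x ] ++ map f xs) ++ ([ g x ] ++ map g xs)    ∎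

  _·_ : Pair → Pair → Pair
  (u , v) · (u′ , v′) = (u A.* u′ , v A.* v′)

  [x]*⊗ : ∀ x ys → [ x ] *⊗ ys ≈⊗ map (x ·_) ys
  [x]*⊗ x ys = ≡⇒≈⊗ (L.++-identityʳ (map (x ·_) ys))

  *⊗[y] : ∀ xs y → xs *⊗ [ y ] ≡ map (_· y) xs
  *⊗[y] []       y = ≡.refl
  *⊗[y] (x ∷ xs) y = ≡.cong (x · y ∷_) (*⊗[y] xs y)

  *⊗-congʳ : ∀ {xs xs′} ys → xs ≈⊗ xs′ → xs *⊗ ys ≈⊗ xs′ *⊗ ys
  *⊗-congʳ ys ⊗-refl          = ⊗-refl
  *⊗-congʳ ys (⊗-sym e)       = ⊗-sym (*⊗-congʳ ys e)
  *⊗-congʳ ys (⊗-trans e e′)  = ⊗-trans (*⊗-congʳ ys e) (*⊗-congʳ ys e′)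
  *⊗-congʳ ys (⊗-++-cong {xs} {xs′} {zs} {zs′} e e′) = begin
    (xs ++ zs) *⊗ ys                  ≡⟨ L.concatMap-++ (λ x → map (x ·_) ys) xs zs ⟩
    (xs *⊗ ys) ++ (zs *⊗ ys)          ≈⟨ ⊗-++-cong (*⊗-congʳ ys e) (*⊗-congʳ ys e′) ⟩
    (xs′ *⊗ ys) ++ (zs′ *⊗ ys)        ≡⟨ L.concatMap-++ (λ x → map (x ·_) ys) xs′ zs′ ⟨
    (xs′ ++ zs′) *⊗ ys                ∎
  *⊗-congʳ ys (⊗-++-comm xs zs) = begin
    (xs ++ zs) *⊗ ys                  ≡⟨ L.concatMap-++ (λ x → map (x ·_) ys) xs zs ⟩
    (xs *⊗ ys) ++ (zs *⊗ ys)          ≈⟨ ⊗-++-comm (xs *⊗ ys) (zs *⊗ ys) ⟩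
    (zs *⊗ ys) ++ (xs *⊗ ys)          ≡⟨ L.concatMap-++ (λ x → map (x ·_) ys) zs xs ⟨
    (zs ++ xs) *⊗ ys                  ∎
  *⊗-congʳ ys (⊗-cong u≈u′ v≈v′) = ∙-congʳ (map-cong⊗ ys (λ _ → ⊗-cong (A.*-congʳ u≈u′) (A.*-congʳ v≈v′)))
  *⊗-congʳ ys (⊗-+ˡ u u′ v) = begin
    [ (u A.+ u′ , v) ] *⊗ ys                          ≈⟨ [x]*⊗ _ ys ⟩
    map ((u A.+ u′ , v) ·_) ys                        ≈⟨ map-split⊗ ys (λ _ → ⊗-trans (⊗-cong (A.distribʳ _ _ _) A.refl) (⊗-+ˡ _ _ _)) ⟩
    map ((u , v) ·_) ys ++ map ((u′ , v) ·_) ys       ≈⟨ ∙-congˡ ([x]*⊗ _ ys) ⟨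
    ((u , v) ∷ (u′ , v) ∷ []) *⊗ ys                   ∎
  *⊗-congʳ ys (⊗-+ʳ u v v′) = begin
    [ (u , v A.+ v′) ] *⊗ ys                          ≈⟨ [x]*⊗ _ ys ⟩
    map ((u , v A.+ v′) ·_) ys                        ≈⟨ map-split⊗ ys (λ _ → ⊗-trans (⊗-cong A.refl (A.distribʳ _ _ _)) (⊗-+ʳ _ _ _)) ⟩
    map ((u , v) ·_) ys ++ map ((u , v′) ·_) ys       ≈⟨ ∙-congˡ ([x]*⊗ _ ys) ⟨
    ((u , v) ∷ (u , v′) ∷ []) *⊗ ys                   ∎
  *⊗-congʳ ys (⊗-0ˡ v) = ⊗-trans ([x]*⊗ _ ys) (map-zeros⊗ ys (λ _ → ⊗-trans (⊗-cong (A.zeroˡ _) A.refl) (⊗-0ˡ _)))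
  *⊗-congʳ ys (⊗-0ʳ u) = ⊗-trans ([x]*⊗ _ ys) (map-zeros⊗ ys (λ _ → ⊗-trans (⊗-cong A.refl (A.zeroˡ _)) (⊗-0ʳ _)))
  *⊗-congʳ ys (⊗-bal x u v) = ∙-congʳ (map-cong⊗ ys (λ y →
    ⊗-trans (⊗-cong (A.•-*-assocˡ x u (proj₁ y)) A.refl) (⊗-trans (⊗-bal x _ _) (⊗-cong A.refl (A.sym (A.•-*-assocˡ x v (proj₂ y)))))))

  map-·-cong : ∀ x {ys ys′} → ys ≈⊗ ys′ → map (x ·_) ys ≈⊗ map (x ·_) ys′
  map-·-cong x ⊗-refl         = ⊗-refl
  map-·-cong x (⊗-sym e)      = ⊗-sym (map-·-cong x e)
  map-·-cong x (⊗-trans e e′) = ⊗-trans (map-·-cong x e) (map-·-cong x e′)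
  map-·-cong x (⊗-++-cong {ys} {ys′} {zs} {zs′} e e′) = begin
    map (x ·_) (ys ++ zs)                   ≡⟨ L.map-++ (x ·_) ys zs ⟩
    map (x ·_) ys ++ map (x ·_) zs          ≈⟨ ⊗-++-cong (map-·-cong x e) (map-·-cong x e′) ⟩
    map (x ·_) ys′ ++ map (x ·_) zs′        ≡⟨ L.map-++ (x ·_) ys′ zs′ ⟨
    map (x ·_) (ys′ ++ zs′)                 ∎
  map-·-cong x (⊗-++-comm ys zs) = begin
    map (x ·_) (ys ++ zs)                   ≡⟨ L.map-++ (x ·_) ys zs ⟩
    map (x ·_) ys ++ map (x ·_) zs          ≈⟨ ⊗-++-comm (map (x ·_) ys) (map (x ·_) zs) ⟩
    map (x ·_) zs ++ map (x ·_) ys          ≡⟨ L.map-++ (x ·_) zs ys ⟨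
    map (x ·_) (zs ++ ys)                   ∎
  map-·-cong x (⊗-cong u≈u′ v≈v′) = ⊗-cong (A.*-congˡ u≈u′) (A.*-congˡ v≈v′)
  map-·-cong x (⊗-+ˡ u u′ v) = ⊗-trans (⊗-cong (A.distribˡ _ _ _) A.refl) (⊗-+ˡ _ _ _)
  map-·-cong x (⊗-+ʳ u v v′) = ⊗-trans (⊗-cong A.refl (A.distribˡ _ _ _)) (⊗-+ʳ _ _ _)
  map-·-cong x (⊗-0ˡ v) = ⊗-trans (⊗-cong (A.zeroʳ _) A.refl) (⊗-0ˡ _)
  map-·-cong x (⊗-0ʳ u) = ⊗-trans (⊗-cong A.refl (A.zeroʳ _)) (⊗-0ʳ _)
  map-·-cong x (⊗-bal c u v) =
    ⊗-trans (⊗-cong (A.•-*-assocʳ c (proj₁ x) u) A.refl) (⊗-trans (⊗-bal c _ _) (⊗-cong A.refl (A.sym (A.•-*-assocʳ c (proj₂ x) v))))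

  *⊗-congˡ : ∀ xs {ys ys′} → ys ≈⊗ ys′ → xs *⊗ ys ≈⊗ xs *⊗ ys′
  *⊗-congˡ []       e = ⊗-refl
  *⊗-congˡ (x ∷ xs) e = ⊗-++-cong (map-·-cong x e) (*⊗-congˡ xs e)

  *⊗-cong : ∀ {xs xs′ ys ys′} → xs ≈⊗ xs′ → ys ≈⊗ ys′ → xs *⊗ ys ≈⊗ xs′ *⊗ ys′
  *⊗-cong {xs} {xs′} {ys} xs≈xs′ ys≈ys′ = ⊗-trans (*⊗-congʳ ys xs≈xs′) (*⊗-congˡ xs′ ys≈ys′)

  map-·-*⊗ : ∀ x ys zs → map (x ·_) ys *⊗ zs ≈⊗ map (x ·_) (ys *⊗ zs)
  map-·-*⊗ x []       zs = ⊗-refl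
  map-·-*⊗ x (y ∷ ys) zs = begin
    map ((x · y) ·_) zs ++ (map (x ·_) ys *⊗ zs)               ≈⟨ ⊗-++-cong (map-cong⊗ zs (λ _ → ⊗-cong (A.*-assoc _ _ _) (A.*-assoc _ _ _))) (map-·-*⊗ x ys zs) ⟩
    map (λ z → x · (y · z)) zs ++ map (x ·_) (ys *⊗ zs)        ≡⟨ ≡.cong (_++ map (x ·_) (ys *⊗ zs)) (L.map-∘ zs) ⟩
    map (x ·_) (map (y ·_) zs) ++ map (x ·_) (ys *⊗ zs)        ≡⟨ L.map-++ (x ·_) (map (y ·_) zs) (ys *⊗ zs) ⟨
    map (x ·_) (map (y ·_) zs ++ (ys *⊗ zs))                   ∎

  *⊗-assoc : ∀ xs ys zs → (xs *⊗ ys) *⊗ zs ≈⊗ xs *⊗ (ys *⊗ zs)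
  *⊗-assoc []       ys zs = ⊗-refl
  *⊗-assoc (x ∷ xs) ys zs = begin
    (map (x ·_) ys ++ (xs *⊗ ys)) *⊗ zs              ≡⟨ L.concatMap-++ (λ w → map (w ·_) zs) (map (x ·_) ys) (xs *⊗ ys) ⟩
    (map (x ·_) ys *⊗ zs) ++ ((xs *⊗ ys) *⊗ zs)      ≈⟨ ⊗-++-cong (map-·-*⊗ x ys zs) (*⊗-assoc xs ys zs) ⟩
    map (x ·_) (ys *⊗ zs) ++ (xs *⊗ (ys *⊗ zs))      ∎

  map-id⊗ : ∀ {f : Pair → Pair} xs → (∀ x → [ f x ] ≈⊗ [ x ]) → map f xs ≈⊗ xs
  map-id⊗ xs f≈id = ⊗-trans (map-cong⊗ xs f≈id) (≡⇒≈⊗ (L.map-id xs))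

  *⊗-identityˡ : ∀ xs → 1⊗ *⊗ xs ≈⊗ xs
  *⊗-identityˡ xs = ⊗-trans ([x]*⊗ _ xs) (map-id⊗ xs (λ _ → ⊗-cong (A.*-identityˡ _) (A.*-identityˡ _)))

  *⊗-identityʳ : ∀ xs → xs *⊗ 1⊗ ≈⊗ xs
  *⊗-identityʳ xs = ⊗-trans (≡⇒≈⊗ (*⊗[y] xs _)) (map-id⊗ xs (λ _ → ⊗-cong (A.*-identityʳ _) (A.*-identityʳ _)))

  *⊗-distribˡ : ∀ xs ys zs → xs *⊗ (ys ++ zs) ≈⊗ (xs *⊗ ys) ++ (xs *⊗ zs)
  *⊗-distribˡ []       ys zs = ⊗-refl
  *⊗-distribˡ (x ∷ xs) ys zs = begin
    map (x ·_) (ys ++ zs) ++ (xs *⊗ (ys ++ zs))                           ≡⟨ ≡.cong (_++ (xs *⊗ (ys ++ zs))) (L.map-++ (x ·_) ys zs) ⟩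
    (map (x ·_) ys ++ map (x ·_) zs) ++ (xs *⊗ (ys ++ zs))                ≈⟨ ∙-congˡ (*⊗-distribˡ xs ys zs) ⟩
    (map (x ·_) ys ++ map (x ·_) zs) ++ ((xs *⊗ ys) ++ (xs *⊗ zs))        ≈⟨ interchange (map (x ·_) ys) (map (x ·_) zs) (xs *⊗ ys) (xs *⊗ zs) ⟩
    (map (x ·_) ys ++ (xs *⊗ ys)) ++ (map (x ·_) zs ++ (xs *⊗ zs))        ∎

  *⊗-distribʳ : ∀ xs ys zs → (ys ++ zs) *⊗ xs ≈⊗ (ys *⊗ xs) ++ (zs *⊗ xs)
  *⊗-distribʳ xs ys zs = ≡⇒≈⊗ (L.concatMap-++ (λ y → map (y ·_) xs) ys zs)

  -⊗_ : T₂ → T₂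
  -⊗ xs = xs *⊗ [ (A.- A.1# , A.1#) ]

  -⊗-inverseˡ : ∀ xs → (-⊗ xs) ++ xs ≈⊗ []
  -⊗-inverseˡ []       = ⊗-refl
  -⊗-inverseˡ (x ∷ xs) = begin
    [ x · (A.- A.1# , A.1#) ] ++ ((-⊗ xs) ++ ([ x ] ++ xs))        ≈⟨ ++-assoc [ x · (A.- A.1# , A.1#) ] (-⊗ xs) ([ x ] ++ xs) ⟨
    ([ x · (A.- A.1# , A.1#) ] ++ (-⊗ xs)) ++ ([ x ] ++ xs)        ≈⟨ interchange [ x · (A.- A.1# , A.1#) ] (-⊗ xs) [ x ] xs ⟩
    ([ x · (A.- A.1# , A.1#) ] ++ [ x ]) ++ ((-⊗ xs) ++ xs)        ≈⟨ ⊗-++-cong (pair≈0 x) (-⊗-inverseˡ xs) ⟩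
    []                                                            ∎
    where
    pair≈0 : ∀ x → [ x · (A.- A.1# , A.1#) ] ++ [ x ] ≈⊗ []
    pair≈0 (u , v) = begin
      (u A.* A.- A.1# , v A.* A.1#) ∷ (u , v) ∷ []    ≈⟨ ∙-congʳ (⊗-cong (A.trans (A.sym (-‿distribʳ-* u A.1#)) (A.-‿cong (A.*-identityʳ u))) (A.*-identityʳ v)) ⟩
      (A.- u , v) ∷ (u , v) ∷ []                      ≈⟨ ⊗-+ˡ _ _ _ ⟨
      [ (A.- u A.+ u , v) ]                           ≈⟨ ⊗-cong (A.-‿inverseˡ u) A.refl ⟩
      [ (A.0# , v) ]                                  ≈⟨ ⊗-0ˡ v ⟩
      []                                              ∎

  tensorRing : Ring a (k ⊔ a ⊔ ℓ)
  tensorRing = record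
    { Carrier = T₂ ; _≈_ = _≈⊗_ ; _+_ = _++_ ; _*_ = _*⊗_ ; -_ = -⊗_ ; 0# = [] ; 1# = 1⊗
    ; isRing = record
      { +-isAbelianGroup = record
        { isGroup = record
          { isMonoid = CommutativeMonoid.isMonoid ⊗-+-commutativeMonoid
          ; inverse = -⊗-inverseˡ , (λ xs → ⊗-trans (⊗-++-comm xs (-⊗ xs)) (-⊗-inverseˡ xs))
          ; ⁻¹-cong = *⊗-congʳ _ }
        ; comm = ⊗-++-comm }
      ; *-cong = *⊗-cong
      ; *-assoc = *⊗-assoc
      ; *-identity = *⊗-identityˡ , *⊗-identityʳ
      ; distrib = *⊗-distribˡ , *⊗-distribʳ } }

  •⊗-cong : ∀ {x y xs ys} → x K.≈ y → xs ≈⊗ ys → x •⊗ xs ≈⊗ y •⊗ ys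
  •⊗-cong {x} {y} {xs} {ys} x≈y xs≈ys = begin
    x •⊗ xs                          ≈⟨ map-cong⊗ xs (λ _ → ⊗-cong (A.•-cong x≈y A.refl) A.refl) ⟩
    y •⊗ xs                          ≈⟨ as-product xs ⟩
    xs *⊗ [ (y A.• A.1# , A.1#) ]    ≈⟨ *⊗-congʳ _ xs≈ys ⟩
    ys *⊗ [ (y A.• A.1# , A.1#) ]    ≈⟨ as-product ys ⟨
    y •⊗ ys                          ∎
    where
    as-product : ∀ zs → y •⊗ zs ≈⊗ zs *⊗ [ (y A.• A.1# , A.1#) ]
    as-product zs = ⊗-sym (⊗-trans (≡⇒≈⊗ (*⊗[y] zs _))
      (map-cong⊗ zs (λ _ → ⊗-cong (A.trans (A.•-*-assocʳ y _ _) (A.•-cong K.refl (A.*-identityʳ _))) (A.*-identityʳ _))))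

  •⊗-*⊗-assocˡ : ∀ x xs ys → (x •⊗ xs) *⊗ ys ≈⊗ x •⊗ (xs *⊗ ys)
  •⊗-*⊗-assocˡ x []       ys = ⊗-refl
  •⊗-*⊗-assocˡ x (z ∷ zs) ys = begin
    map ((x A.• proj₁ z , proj₂ z) ·_) ys ++ ((x •⊗ zs) *⊗ ys)     ≈⟨ ⊗-++-cong (map-cong⊗ ys (λ _ → ⊗-cong (A.•-*-assocˡ x _ _) A.refl)) (•⊗-*⊗-assocˡ x zs ys) ⟩
    map (λ y → scale (z · y)) ys ++ (x •⊗ (zs *⊗ ys))               ≡⟨ ≡.cong (_++ (x •⊗ (zs *⊗ ys))) (L.map-∘ ys) ⟩
    map scale (map (z ·_) ys) ++ (x •⊗ (zs *⊗ ys))                  ≡⟨ L.map-++ scale (map (z ·_) ys) (zs *⊗ ys) ⟨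
    x •⊗ (map (z ·_) ys ++ (zs *⊗ ys))                              ∎
    where
    scale : Pair → Pair
    scale w = (x A.• proj₁ w , proj₂ w)

  •⊗-*⊗-assocʳ : ∀ x xs ys → xs *⊗ (x •⊗ ys) ≈⊗ x •⊗ (xs *⊗ ys)
  •⊗-*⊗-assocʳ x []       ys = ⊗-refl
  •⊗-*⊗-assocʳ x (z ∷ zs) ys = begin
    map (z ·_) (map scale ys) ++ (zs *⊗ (x •⊗ ys))                  ≡⟨ ≡.cong (_++ (zs *⊗ (x •⊗ ys))) (L.map-∘ ys) ⟨
    map (λ y → z · scale y) ys ++ (zs *⊗ (x •⊗ ys))                 ≈⟨ ⊗-++-cong (map-cong⊗ ys (λ _ → ⊗-cong (A.•-*-assocʳ x _ _) A.refl)) (•⊗-*⊗-assocʳ x zs ys) ⟩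
    map (λ y → scale (z · y)) ys ++ (x •⊗ (zs *⊗ ys))               ≡⟨ ≡.cong (_++ (x •⊗ (zs *⊗ ys))) (L.map-∘ ys) ⟩
    map scale (map (z ·_) ys) ++ (x •⊗ (zs *⊗ ys))                  ≡⟨ L.map-++ scale (map (z ·_) ys) (zs *⊗ ys) ⟨
    x •⊗ (map (z ·_) ys ++ (zs *⊗ ys))                              ∎
    where
    scale : Pair → Pair
    scale w = (x A.• proj₁ w , proj₂ w)

  tensorAlgebra : KAlgebra K a (k ⊔ a ⊔ ℓ)
  tensorAlgebra = record
    { baseRing = tensorRing
    ; _•_ = _•⊗_
    ; •-cong = •⊗-cong
    ; •-distribˡ = λ x xs ys → ≡⇒≈⊗ (L.map-++ _ xs ys)
    ; •-distribʳ = λ x y xs → map-split⊗ xs (λ _ → ⊗-trans (⊗-cong (A.•-distribʳ x y _) A.refl) (⊗-+ˡ _ _ _))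
    ; •-assoc = λ x y xs → ⊗-trans (map-cong⊗ xs (λ _ → ⊗-cong (A.•-assoc x y _) A.refl)) (≡⇒≈⊗ (L.map-∘ xs))
    ; •-identity = λ xs → map-id⊗ xs (λ _ → ⊗-cong (A.•-identity _) A.refl)
    ; •-*-assocˡ = •⊗-*⊗-assocˡ
    ; •-*-assocʳ = •⊗-*⊗-assocʳ }

module BialgebraSeries {k kℓ a ℓ : Level} {K : QAlgebra k kℓ} (B : Bialgebra K a ℓ) where
  private
    module K = QAlgebra K
    module B = Bialgebra B
    A : KAlgebra K a ℓ
    A = B.algebra
    module A = KAlgebra A
    module PA = PowerSeries A
    A⊗A : KAlgebra K a (k ⊔ a ⊔ ℓ)
    A⊗A = TensorSquare.tensorAlgebra A
    module A⊗A = KAlgebra A⊗A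
    module PT = PowerSeries A⊗A
    module ST = PowerSeriesAlgebra A⊗A
    module 𝕋 = Ring ST.seriesRing
  open Tensors A
  open import Relation.Binary.Reasoning.Setoid 𝕋.setoid

  Δ-homomorphism : KAlgebraHomomorphism A A⊗A
  Δ-homomorphism = record
    { ⟦_⟧ = B.Δ ; ⟦⟧-cong = B.Δ-cong ; +-homo = B.Δ-+ ; *-homo = B.Δ-* ; •-homo = B.Δ-• ; 1#-homo = B.Δ-1 }

  ι₁-homomorphism : KAlgebraHomomorphism A A⊗A
  ι₁-homomorphism = record
    { ⟦_⟧ = λ u → [ (u , A.1#) ] ; ⟦⟧-cong = λ u≈v → ⊗-cong u≈v A.refl ; +-homo = λ u v → ⊗-+ˡ u v A.1#
    ; *-homo = λ u v → ⊗-cong A.refl (A.sym (A.*-identityˡ A.1#)) ; •-homo = λ x u → ⊗-refl ; 1#-homo = ⊗-refl }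

  ι₂-homomorphism : KAlgebraHomomorphism A A⊗A
  ι₂-homomorphism = record
    { ⟦_⟧ = λ u → [ (A.1# , u) ] ; ⟦⟧-cong = λ u≈v → ⊗-cong A.refl u≈v ; +-homo = λ u v → ⊗-+ʳ A.1# u v
    ; *-homo = λ u v → ⊗-cong (A.sym (A.*-identityˡ A.1#)) A.refl ; •-homo = λ x u → ⊗-sym (⊗-bal x A.1# u) ; 1#-homo = ⊗-refl }

  module Δₛ = SeriesHomomorphism Δ-homomorphism
  module ι₁ₛ = SeriesHomomorphism ι₁-homomorphism
  module ι₂ₛ = SeriesHomomorphism ι₂-homomorphism

  Δₛ ι₁ₛ ι₂ₛ : PA.Series → PT.Series
  Δₛ  = Δₛ.mapₛ
  ι₁ₛ = ι₁ₛ.mapₛ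
  ι₂ₛ = ι₂ₛ.mapₛ

  ι₁ₛ-ι₂ₛ-comm : ∀ p q → ι₁ₛ p PT.⋆ ι₂ₛ q PT.≈ₛ ι₂ₛ q PT.⋆ ι₁ₛ p
  ι₁ₛ-ι₂ₛ-comm p q = ST.⋆-comm (ι₁ₛ p) (ι₂ₛ q) (λ i j →
    ⊗-cong (A.trans (A.*-identityʳ _) (A.sym (A.*-identityˡ _))) (A.trans (A.*-identityˡ _) (A.sym (A.*-identityʳ _))))

  infixl 7 _⊠_
  _⊠_ : PA.Series → PA.Series → PT.Series
  p ⊠ q = ι₁ₛ p PT.⋆ ι₂ₛ q

  ⊠-cong : ∀ {p p′ q q′} → p PA.≈ₛ p′ → q PA.≈ₛ q′ → p ⊠ q PT.≈ₛ p′ ⊠ q′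
  ⊠-cong p≈p′ q≈q′ = 𝕋.*-cong (ι₁ₛ.mapₛ-cong p≈p′) (ι₂ₛ.mapₛ-cong q≈q′)

  ⊠-coeff : ∀ p q n → (p ⊠ q) n ≈⊗ map (λ i → (p i , q (n ∸ i))) (upTo (suc n))
  ⊠-coeff p q n = ⊗-trans (≡⇒≈⊗ (≡.trans (≡.cong concat (L.map-∘ {g = [_]} {f = pair} (upTo (suc n)))) (L.concat-map-[ map pair (upTo (suc n)) ])))
    (map-cong⊗ (upTo (suc n)) (λ i → ⊗-cong (A.*-identityʳ _) (A.*-identityˡ _)))
    where
    open TensorSquare A using (≡⇒≈⊗; map-cong⊗)
    pair : ℕ → A.Carrier × A.Carrier
    pair i = (p i A.* A.1# , A.1# A.* q (n ∸ i))

  IsDividedPowers⇔Δₛ≈⊠ : ∀ s → IsDividedPowers B s ⇔ Δₛ s PT.≈ₛ s ⊠ s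
  IsDividedPowers⇔Δₛ≈⊠ s = mk⇔ (λ dp n → ⊗-trans (dp n) (⊗-sym (⊠-coeff s s n))) (λ Δs≈s⊠s n → ⊗-trans (Δs≈s⊠s n) (⊠-coeff s s n))

  ⊠-⋆ : ∀ p q p′ q′ → (p PA.⋆ q) ⊠ (p′ PA.⋆ q′) PT.≈ₛ (p ⊠ p′) PT.⋆ (q ⊠ q′)
  ⊠-⋆ p q p′ q′ = begin
    ι₁ₛ (p PA.⋆ q) PT.⋆ ι₂ₛ (p′ PA.⋆ q′)                   ≈⟨ 𝕋.*-cong (ι₁ₛ.mapₛ-⋆ p q) (ι₂ₛ.mapₛ-⋆ p′ q′) ⟩
    (ι₁ₛ p PT.⋆ ι₁ₛ q) PT.⋆ (ι₂ₛ p′ PT.⋆ ι₂ₛ q′)           ≈⟨ 𝕋.*-assoc (ι₁ₛ p) (ι₁ₛ q) (ι₂ₛ p′ PT.⋆ ι₂ₛ q′) ⟩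
    ι₁ₛ p PT.⋆ (ι₁ₛ q PT.⋆ (ι₂ₛ p′ PT.⋆ ι₂ₛ q′))           ≈⟨ 𝕋.*-congˡ {ι₁ₛ p} (𝕋.*-assoc (ι₁ₛ q) (ι₂ₛ p′) (ι₂ₛ q′)) ⟨
    ι₁ₛ p PT.⋆ ((ι₁ₛ q PT.⋆ ι₂ₛ p′) PT.⋆ ι₂ₛ q′)           ≈⟨ 𝕋.*-congˡ {ι₁ₛ p} (𝕋.*-congʳ {ι₂ₛ q′} (ι₁ₛ-ι₂ₛ-comm q p′)) ⟩
    ι₁ₛ p PT.⋆ ((ι₂ₛ p′ PT.⋆ ι₁ₛ q) PT.⋆ ι₂ₛ q′)           ≈⟨ 𝕋.*-congˡ {ι₁ₛ p} (𝕋.*-assoc (ι₂ₛ p′) (ι₁ₛ q) (ι₂ₛ q′)) ⟩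
    ι₁ₛ p PT.⋆ (ι₂ₛ p′ PT.⋆ (ι₁ₛ q PT.⋆ ι₂ₛ q′))           ≈⟨ 𝕋.*-assoc (ι₁ₛ p) (ι₂ₛ p′) (ι₁ₛ q PT.⋆ ι₂ₛ q′) ⟨
    (p ⊠ p′) PT.⋆ (q ⊠ q′)                                ∎

  ⊠-oneₛ : PA.oneₛ ⊠ PA.oneₛ PT.≈ₛ PT.oneₛ
  ⊠-oneₛ = 𝕋.trans (𝕋.*-cong ι₁ₛ.mapₛ-oneₛ ι₂ₛ.mapₛ-oneₛ) (𝕋.*-identityˡ _)

  ⊠-reflectₛ : ∀ p q → PA.reflectₛ p ⊠ PA.reflectₛ q PT.≈ₛ PT.reflectₛ (p ⊠ q)
  ⊠-reflectₛ p q = 𝕋.trans (𝕋.*-cong (ι₁ₛ.mapₛ-reflectₛ p) (ι₂ₛ.mapₛ-reflectₛ q)) (𝕋.sym (Reflection.reflectₛ-⋆ A⊗A (ι₁ₛ p) (ι₂ₛ q)))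

  ⊠-derivₛ≈⋆ʳ : ∀ {p q r s} → PA.derivₛ p PA.≈ₛ p PA.⋆ r → PA.derivₛ q PA.≈ₛ q PA.⋆ s →
    PT.derivₛ (p ⊠ q) PT.≈ₛ (p ⊠ q) PT.⋆ (ι₁ₛ r ST.+ₛ ι₂ₛ s)
  ⊠-derivₛ≈⋆ʳ {p} {q} {r} {s} p′≈pr q′≈qs = LogarithmicDerivatives.derivₛ-⋆-right-log A⊗A {ι₁ₛ p} {ι₂ₛ q} {ι₁ₛ r} {ι₂ₛ s}
    (ι₁ₛ.mapₛ-derivₛ≈⋆ʳ p′≈pr) (ι₂ₛ.mapₛ-derivₛ≈⋆ʳ q′≈qs) (ι₁ₛ-ι₂ₛ-comm r q)

  ⊠-derivₛ≈⋆ˡ : ∀ {p q r s} → PA.derivₛ p PA.≈ₛ r PA.⋆ p → PA.derivₛ q PA.≈ₛ s PA.⋆ q →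
    PT.derivₛ (p ⊠ q) PT.≈ₛ (ι₁ₛ r ST.+ₛ ι₂ₛ s) PT.⋆ (p ⊠ q)
  ⊠-derivₛ≈⋆ˡ {p} {q} {r} {s} p′≈rp q′≈sq = LogarithmicDerivatives.derivₛ-⋆-left-log A⊗A {ι₁ₛ p} {ι₂ₛ q} {ι₁ₛ r} {ι₂ₛ s}
    (ι₁ₛ.mapₛ-derivₛ≈⋆ˡ p′≈rp) (ι₂ₛ.mapₛ-derivₛ≈⋆ˡ q′≈sq) (ι₁ₛ-ι₂ₛ-comm p s)

  ⊠-expₛ : ∀ {p q} → p 0 A.≈ A.0# → q 0 A.≈ A.0# → PA.expₛ p ⊠ PA.expₛ q PT.≈ₛ PT.expₛ (ι₁ₛ p ST.+ₛ ι₂ₛ q)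
  ⊠-expₛ {p} {q} p₀≈0 q₀≈0 = begin
    ι₁ₛ (PA.expₛ p) PT.⋆ ι₂ₛ (PA.expₛ q)      ≈⟨ 𝕋.*-cong (ι₁ₛ.mapₛ-expₛ p) (ι₂ₛ.mapₛ-expₛ q) ⟩
    PT.expₛ (ι₁ₛ p) PT.⋆ PT.expₛ (ι₂ₛ q)      ≈⟨ ExponentialOfSum.expₛ-+ A⊗A (ι₁ₛ.⟦⟧-≈0 p₀≈0) (ι₂ₛ.⟦⟧-≈0 q₀≈0) (ι₁ₛ-ι₂ₛ-comm p q) ⟨
    PT.expₛ (ι₁ₛ p ST.+ₛ ι₂ₛ q)               ∎

  primitive⇔Δₛ≈ι₁ₛ+ι₂ₛ : ∀ p → (∀ n → IsPrimitive B (p n)) ⇔ Δₛ p PT.≈ₛ ι₁ₛ p ST.+ₛ ι₂ₛ p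
  primitive⇔Δₛ≈ι₁ₛ+ι₂ₛ p = ≈-resp-⇔ 𝕋.setoid 𝕋.refl (𝕋.+-comm (ι₂ₛ p) (ι₁ₛ p))

  primitive-derivₛ⇔Δₛ≈ι₁ₛ+ι₂ₛ : ∀ {p} → p 0 A.≈ A.0# → (∀ n → IsPrimitive B (PA.derivₛ p n)) ⇔ Δₛ p PT.≈ₛ ι₁ₛ p ST.+ₛ ι₂ₛ p
  primitive-derivₛ⇔Δₛ≈ι₁ₛ+ι₂ₛ {p} p₀≈0 = ⇔-trans (primitive⇔Δₛ≈ι₁ₛ+ι₂ₛ (PA.derivₛ p)) (⇔-trans
    (≈-resp-⇔ 𝕋.setoid (Δₛ.mapₛ-derivₛ p) (𝕋.trans (𝕋.+-cong (ι₁ₛ.mapₛ-derivₛ p) (ι₂ₛ.mapₛ-derivₛ p)) (𝕋.sym (ST.derivₛ-+ₛ (ι₁ₛ p) (ι₂ₛ p)))))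
    (⇔-sym (ST.≈ₛ⇔derivₛ-≈ₛ (⊗-trans (Δₛ.⟦⟧-≈0 p₀≈0) (⊗-sym (⊗-++-cong (ι₁ₛ.⟦⟧-≈0 p₀≈0) (ι₂ₛ.⟦⟧-≈0 p₀≈0)))))))

  ⊠-⋆≈oneₛ : ∀ {p q} → p PA.⋆ q PA.≈ₛ PA.oneₛ → (p ⊠ p) PT.⋆ (q ⊠ q) PT.≈ₛ PT.oneₛ
  ⊠-⋆≈oneₛ {p} {q} pq≈1 = 𝕋.trans (𝕋.sym (⊠-⋆ p q p q)) (𝕋.trans (⊠-cong pq≈1 pq≈1) ⊠-oneₛ)

module NCSSystem {k kℓ a ℓ : Level} {K : QAlgebra k kℓ} (B : Bialgebra K a ℓ) (f g d h m : PowerSeries.Series (Bialgebra.algebra B))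
                 (ncs : PowerSeries.IsNCS (Bialgebra.algebra B) f g d h m) where
  private
    module B = Bialgebra B
    A : KAlgebra K a ℓ
    A = B.algebra
    module A = KAlgebra A
    module PA = PowerSeries A
    A⊗A : KAlgebra K a (k ⊔ a ⊔ ℓ)
    A⊗A = TensorSquare.tensorAlgebra A
    module PT = PowerSeries A⊗A
    module ST = PowerSeriesAlgebra A⊗A
    module 𝕋 = Ring ST.seriesRing
  open Tensors A
  open BialgebraSeries B
  open PowerSeries.IsNCS ncs
  open LogarithmicDerivatives A⊗A

  F : PA.Series
  F = PA.reflectₛ f

  g₀≈1 : g 0 A.≈ A.1#
  g₀≈1 = A.trans (A.sym (exp-d 0)) (Exponential.expₛ-0 A d)

  Δg₀≈[g⊠g]₀ : Δₛ g 0 ≈⊗ (g ⊠ g) 0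
  Δg₀≈[g⊠g]₀ = ⊗-trans (B.Δ-cong g₀≈1) (⊗-trans B.Δ-1 (⊗-sym (⊗-trans (⊠-coeff g g 0) (⊗-cong g₀≈1 g₀≈1))))

  Δg≈g⊠g⇔h-primitive : Δₛ g PT.≈ₛ g ⊠ g ⇔ (∀ n → IsPrimitive B (h n))
  Δg≈g⊠g⇔h-primitive = ⇔-trans
    (≈ₛ⇔right-log-derivative-≈ₛ {Δₛ F} {Δₛ g} {g ⊠ g} {Δₛ h} {ι₁ₛ h ST.+ₛ ι₂ₛ h} (Δₛ.mapₛ-⋆≈oneₛ f-g) Δg₀≈[g⊠g]₀
      (Δₛ.mapₛ-derivₛ≈⋆ʳ g′-h) (⊠-derivₛ≈⋆ʳ g′-h g′-h))
    (⇔-sym (primitive⇔Δₛ≈ι₁ₛ+ι₂ₛ h))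

  Δg≈g⊠g⇔m-primitive : Δₛ g PT.≈ₛ g ⊠ g ⇔ (∀ n → IsPrimitive B (m n))
  Δg≈g⊠g⇔m-primitive = ⇔-trans
    (≈ₛ⇔left-log-derivative-≈ₛ {Δₛ F} {Δₛ g} {g ⊠ g} {Δₛ m} {ι₁ₛ m ST.+ₛ ι₂ₛ m} (Δₛ.mapₛ-⋆≈oneₛ g-f) Δg₀≈[g⊠g]₀
      (Δₛ.mapₛ-derivₛ≈⋆ˡ g′-m) (⊠-derivₛ≈⋆ˡ g′-m g′-m))
    (⇔-sym (primitive⇔Δₛ≈ι₁ₛ+ι₂ₛ m))

  Δg≈g⊠g⇔d′-primitive : Δₛ g PT.≈ₛ g ⊠ g ⇔ (∀ n → IsPrimitive B (PA.derivₛ d n))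
  Δg≈g⊠g⇔d′-primitive = ⇔-trans
    (≈-resp-⇔ 𝕋.setoid Δg≈e^Δd g⊠g≈e^[ι₁d+ι₂d])
    (⇔-trans (⇔-sym (Exponential.≈ₛ⇔expₛ-≈ₛ A⊗A (Δₛ.⟦⟧-≈0 d-0) (⊗-++-cong (ι₁ₛ.⟦⟧-≈0 d-0) (ι₂ₛ.⟦⟧-≈0 d-0))))
             (⇔-sym (primitive-derivₛ⇔Δₛ≈ι₁ₛ+ι₂ₛ d-0)))
    where
    g≈e^d : g PA.≈ₛ PA.expₛ d
    g≈e^d n = A.sym (exp-d n)
    Δg≈e^Δd : Δₛ g PT.≈ₛ PT.expₛ (Δₛ d)
    Δg≈e^Δd = 𝕋.trans (Δₛ.mapₛ-cong g≈e^d) (Δₛ.mapₛ-expₛ d)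
    g⊠g≈e^[ι₁d+ι₂d] : g ⊠ g PT.≈ₛ PT.expₛ (ι₁ₛ d ST.+ₛ ι₂ₛ d)
    g⊠g≈e^[ι₁d+ι₂d] = 𝕋.trans (⊠-cong g≈e^d g≈e^d) (⊠-expₛ d-0 d-0)

  Δf≈f⊠f⇔Δg≈g⊠g : Δₛ f PT.≈ₛ f ⊠ f ⇔ Δₛ g PT.≈ₛ g ⊠ g
  Δf≈f⊠f⇔Δg≈g⊠g = ⇔-trans (Reflection.≈ₛ⇔reflectₛ-≈ₛ A⊗A) (⇔-trans
    (≈-resp-⇔ 𝕋.setoid (𝕋.sym (Δₛ.mapₛ-reflectₛ f)) (𝕋.sym (⊠-reflectₛ f f)))
    (inverses-≈⇔ 𝕋.*-monoid (Δₛ.mapₛ-⋆≈oneₛ f-g) (Δₛ.mapₛ-⋆≈oneₛ g-f) (⊠-⋆≈oneₛ f-g) (⊠-⋆≈oneₛ g-f)))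

open import Defs using (Series; IsNCS; natK)

proposition2p12 : ∀ {k kℓ a ℓ : Level} (K : QAlgebra k kℓ) (A : Bialgebra K a ℓ)
    (f g d h m : Series (Bialgebra.algebra A)) →
    IsNCS (Bialgebra.algebra A) f g d h m →
    (IsDividedPowers A f ⇔ IsDividedPowers A g)
    × (IsDividedPowers A g ⇔ (∀ (n : ℕ) → IsPrimitive A (Bialgebra._•_ A (natK (Bialgebra.algebra A) (suc n)) (d (suc n)))))
    × (IsDividedPowers A g ⇔ (∀ (n : ℕ) → IsPrimitive A (h n)))
    × (IsDividedPowers A g ⇔ (∀ (n : ℕ) → IsPrimitive A (m n)))
proposition2p12 K A f g d h m ncs =
    ⇔-trans (IsDividedPowers⇔Δₛ≈⊠ f) (⇔-trans Δf≈f⊠f⇔Δg≈g⊠g (⇔-sym (IsDividedPowers⇔Δₛ≈⊠ g)))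
  , ⇔-trans (IsDividedPowers⇔Δₛ≈⊠ g) Δg≈g⊠g⇔d′-primitive
  , ⇔-trans (IsDividedPowers⇔Δₛ≈⊠ g) Δg≈g⊠g⇔h-primitive
  , ⇔-trans (IsDividedPowers⇔Δₛ≈⊠ g) Δg≈g⊠g⇔m-primitive
  where
  open BialgebraSeries A
  open NCSSystem A f g d h m ncs
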